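{- Let $\Pi$ be a finite set of proposition symbols and $I=[a]$ with $a\in\mathbb{Z}_{+}$. Every $(\Pi,I)$-formula $\varphi$ of $\mathrm{GMML}$ of modal depth $n$ is logically equivalent to a recursively enumerable disjunction of full graded multimodal $(\Pi,I)$-types of modal depth $n$.
   Context: $(\Pi,I)$-formulae of graded multimodal logic ($\mathrm{GMML}$) are generated by $\varphi ::= \top \mid p \mid \neg\varphi \mid (\varphi\land\varphi)\mid \langle\alpha\rangle_{\geq k}\varphi$ with $p\in\Pi$, $\alpha\in I$, $k\in\mathbb{N}$. A $(\Pi,I)$-model is $M=(W,(R_\alpha)_{\alpha\in I},V)$ with $W\neq\emptyset$ finite, $R_\alpha\subseteq W\times W$, $V:\Pi\to\wp(W)$; a pointed model is $(M,w)$ with $w\in W$. Semantics are as usual for $\top,p,\neg,\land$, and $(M,w)\models\langle\alpha\rangle_{\geq k}\psi$ iff $|\{v : (w,v)\in R_\alpha,\ (M,v)\models\psi\}|\geq k$. Write $\langle\alpha\rangle_{=k}\psi$ for $\langle\alpha\rangle_{\geq k}\psi\land\neg\langle\alpha\rangle_{\geq k+1}\psi$. The modal depth is the maximal nesting of diamonds. A countable disjunction $\bigvee_{\varphi\in S}\varphi$ is true at $(M,w)$ iff some $\varphi\in S$ is; it is recursively enumerable if $S$ is recursively enumerable. Logical equivalence means being satisfied by exactly the same pointed models. Let $\mathcal{N}^\alpha(w)=\{v:(w,v)\in R_\alpha\}$. Graded types: for $\mathbf{k}=\varepsilon$ (empty tuple), $\tau^{(M,w)}_{\varepsilon}=\bigwedge_{w\in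 V(p)}p\land\bigwedge_{w\notin V(p)}\neg p$ (over $p\in\Pi$, with canonical bracketing and ordering; $\top$ if $\Pi=\emptyset$). Given that types of width $\mathbf{k}=(\mathbf{k}_1,\dots,\mathbf{k}_n)\in(\mathbb{N}^{|I|})^n$ are defined for all pointed models, let $T_{\mathbf{k}}$ be the set of all of them, and for $\mathbf{k}_0=(k_1,\dots,k_{|I|})\in\mathbb{N}^{|I|}$ let $\tau^{(M,w)}_{(\mathbf{k}_0,\mathbf{k}_1,\dots,\mathbf{k}_n)}$ be the conjunction of: $\tau^{(M,w)}_\varepsilon$; all $\langle\alpha\rangle_{=\ell}\tau$ with $\alpha\in I$, $1\le\ell\le k_\alpha-1$, $\tau\in T_{\mathbf{k}}$ and $(M,w)\models\langle\alpha\rangle_{=\ell}\tau$; all $\langle\alpha\rangle_{\geq k_\alpha}\tau$ with $\alpha\in I$, $\tau\in T_{\mathbf{k}}$, $(M,w)\models\langle\alpha\rangle_{\ge k_\alpha}\tau$; and all $\langle\alpha\rangle_{=|\mathcal{N}^\alpha(w)|}\top$ with $\alpha\in I$ and $k_\alpha>|\mathcal{N}^\alpha(w)|$. The full graded multimodal $(\Pi,I)$-type of modal depth $0$ of $(M,w)$ is $\tau^{(M,w)}_\varepsilon$; a full graded multimodal $(\Pi,I)$-type of modal depth $n+1$ of $(M,w)$ is any $\tau^{(M,w)}_{(\mathbf{k}_1,\dots,\mathbf{k}_{n+1})}$ with $\mathbf{k}_i=(k_{i,1},\dots,k_{i,|I|})$ satisfying $k_{i,\alpha}>\max\{|\mathcal{N}^\alpha(v)|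 : (w,v)\in(\bigcup_{\beta\in I}R_\beta)^{i-1}\}$ for all $i\in[n+1]$, $\alpha\in I$. A full graded multimodal $(\Pi,I)$-type of modal depth $n$ is such a formula for some pointed model. -}

module Defs where

open import Data.Nat using (ℕ; zero; suc; _+_; _<_; _≤_; _≤ᵇ_; _⊔_)
open import Data.Fin using (Fin; toℕ) renaming (zero to fzero; suc to fsuc)
open import Data.Bool using (Bool; true; false; not; _∧_; if_then_else_)
open import Data.List using (List; []; _∷_; _++_; map)
open import Data.List.Membership.Propositional using (_∈_)
open import Data.List.Relation.Unary.Linked using (Linked)
open import Data.List.Relation.Binary.Lex.Core using (Lex-<)
open import Data.Vec using (Vec; []; _∷_; lookup)
open import Data.Vec.Functional using () renaming (toList to vtoList)
open import Data.Product using (Σ; ∃; _×_; _,_)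
open import Data.Sum using (_⊎_)
open import Relation.Binary.PropositionalEquality using (_≡_)
open import Function.Bundles using (_⇔_)

-- Syntax of GMML with Π = Fin m (finitely many proposition symbols)
-- and index set I = Fin a.

data Fm (m a : ℕ) : Set where
  ⊤'  : Fm m a
  var : Fin m → Fm m a
  ¬'_ : Fm m a → Fm m a
  _∧'_ : Fm m a → Fm m a → Fm m a
  ◇≥  : Fin a → ℕ → Fm m a → Fm m a

◇= : ∀ {m a} → Fin a → ℕ → Fm m a → Fm m a
◇= α k φ = ◇≥ α k φ ∧' (¬' ◇≥ α (suc k) φ)

md : ∀ {m a} → Fm m a → ℕ
md ⊤' = 0
md (var p) = 0
md (¬' φ) = md φ
md (φ ∧' ψ) = md φ ⊔ md ψ
md (◇≥ α k φ) = suc (md φ)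

-- Finite Kripke models: W = Fin size (nonempty whenever a point is given).

record Model (m a : ℕ) : Set where
  field
    size : ℕ
    R    : Fin a → Fin size → Fin size → Bool
    V    : Fin m → Fin size → Bool
open Model public

count : ∀ {n} → (Fin n → Bool) → ℕ
count {zero} f = 0
count {suc n} f = (if f fzero then 1 else 0) + count (λ i → f (fsuc i))

deg : ∀ {m a} (M : Model m a) → Fin a → Fin (size M) → ℕ
deg M α w = count (R M α w)

sat : ∀ {m a} (M : Model m a) → Fm m a → Fin (size M) → Bool
sat M ⊤' w = true
sat M (var p) w = V M p w
sat M (¬' φ) w = not (sat M φ w)
sat M (φ ∧' ψ) w = sat M φ w ∧ sat M ψ w
sat M (◇≥ α k φ) w = k ≤ᵇ count (λ v → R M α w v ∧ sat M φ v)

_,_⊨_ : ∀ {m a} (M : Model m a) → Fin (size M) → Fm m a → Set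
M , w ⊨ φ = sat M φ w ≡ true

conj : ∀ {m a} → List (Fm m a) → Fm m a
conj [] = ⊤'
conj (x ∷ []) = x
conj (x ∷ xs@(_ ∷ _)) = x ∧' conj xs

-- Canonical ordering of formulas: lexicographic order of a
-- (prefix-free, injective) Polish-notation code in List ℕ.
encode : ∀ {m a} → Fm m a → List ℕ
encode ⊤' = 0 ∷ []
encode (var p) = 1 ∷ toℕ p ∷ []
encode (¬' φ) = 2 ∷ encode φ
encode (φ ∧' ψ) = 3 ∷ (encode φ ++ encode ψ)
encode (◇≥ α k φ) = 4 ∷ toℕ α ∷ k ∷ encode φ

_≺_ : ∀ {m a} → Fm m a → Fm m a → Set
φ ≺ ψ = Lex-< _≡_ _<_ (encode φ) (encode ψ)

-- ψ is the canonical conjunction of exactly the formulas satisfying C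
-- (listed in strictly increasing canonical order, hence without repetition).
IsConjOf : ∀ {m a} → (Fm m a → Set) → Fm m a → Set
IsConjOf C ψ = Σ (List _) λ L → Linked _≺_ L × (∀ χ → (χ ∈ L) ⇔ C χ) × (ψ ≡ conj L)

lit : ∀ {m a} (M : Model m a) → Fin (size M) → Fin m → Fm m a
lit M w p = if V M p w then var p else (¬' var p)

τε : ∀ {m a} (M : Model m a) → Fin (size M) → Fm m a
τε {m} M w = conj (vtoList (λ p → lit M w p))

-- A width is a vector (k_0, ..., k_{n-1}), each k_i ∈ ℕ^{|I|}; head = outermost.
Width : ℕ → ℕ → Set
Width a n = Vec (Fin a → ℕ) n

IsTypeOf : ∀ {m a n} → Width a n → (M : Model m a) → Fin (size M) → Fm m a → Set
InT : ∀ {m a n} → Width a n → Fm m a → Set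

IsTypeOf [] M w ψ = ψ ≡ τε M w
IsTypeOf {m} {a} (k₀ ∷ ks) M w ψ = IsConjOf Conjunct ψ
  where
  Conjunct : Fm m a → Set
  Conjunct χ =
      (χ ≡ τε M w)
    ⊎ (Σ (Fin a) λ α → Σ ℕ λ ℓ → Σ (Fm m a) λ τ →
         1 ≤ ℓ × suc ℓ ≤ k₀ α × InT ks τ × (M , w ⊨ ◇= α ℓ τ) × χ ≡ ◇= α ℓ τ)
    ⊎ (Σ (Fin a) λ α → Σ (Fm m a) λ τ →
         InT ks τ × (M , w ⊨ ◇≥ α (k₀ α) τ) × χ ≡ ◇≥ α (k₀ α) τ)
    ⊎ (Σ (Fin a) λ α → deg M α w < k₀ α × χ ≡ ◇= α (deg M α w) ⊤')

InT {m} {a} ks τ = Σ (Model m a) λ M' → Σ (Fin (size M')) λ w' → IsTypeOf ks M' w' τ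

Reach : ∀ {m a} (M : Model m a) → ℕ → Fin (size M) → Fin (size M) → Set
Reach M zero w v = w ≡ v
Reach {a = a} M (suc j) w v =
  Σ (Fin (size M)) λ u → Reach M j w u × Σ (Fin a) λ β → R M β u v ≡ true

-- k_{i,α} > max{ |N^α(v)| : v reachable in i-1 steps }  (with max ∅ = 0);
-- here i is 0-based, so the reachability distance is i.
FullWidth : ∀ {m a n} (M : Model m a) → Fin (size M) → Width a n → Set
FullWidth {a = a} {n} M w ks =
  ∀ (i : Fin n) (α : Fin a) →
    (0 < lookup ks i α) ×
    (∀ v → Reach M (toℕ i) w v → deg M α v < lookup ks i α)

IsFullType : ∀ {m a} → ℕ → Fm m a → Set
IsFullType {m} {a} n ψ =
  Σ (Model m a) λ M → Σ (Fin (size M)) λ w → Σ (Width a n) λ ks →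
    FullWidth M w ks × IsTypeOf ks M w ψ

-- The canonical type fullType d M w records the literals true at w, the number of
-- α-successors of w, and for each α-successor v the exact number of α-successors satisfying
-- fullType (d ∸ 1) M v. Any point satisfying fullType d M w agrees with (M, w) on all formulas
-- of depth ≤ d: the successors of the two points fall into the same classes of depth-(d ∸ 1)
-- equivalence with the same sizes, so ⟨α⟩_{≥k} φ can be counted class by class.
-- If every degree in M is below K, fullType d M w is the graded type of width (K, …, K) of
-- (M, w), hence a full type. This is proved together with the uniqueness of such types at
-- points of M, by induction on d; the induction uses types of arbitrary models, which exist
-- only under double negation, harmlessly since the goals are Boolean equations.
-- The disjunction for φ runs through all finite pointed models, decoded from the binary
-- digits of the index, and returns the canonical full type of depth md φ of those satisfying φ.
-- Nothing depends on the index set Fin (suc a′) being nonempty.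

{-# OPTIONS --safe #-}
module Submission where

open import Defs
open import Data.Bool using (Bool; true; false; not; _∧_; if_then_else_)
open import Data.Bool.Properties
  using (T-≡; ∧-identityʳ; ∧-zeroʳ; ∧-assoc; ∧-comm; ¬-not; ⇔→≡; not-injective) renaming (_≟_ to _≟ᵇ_)
open import Data.Empty using (⊥; ⊥-elim)
open import Data.Fin using (Fin; toℕ; fromℕ<) renaming (zero to fzero; suc to fsuc)
open import Data.Fin.Properties using (toℕ-injective; toℕ<n; fromℕ<-toℕ; sequence)
open import Data.List using (List; []; _∷_; _++_; foldr; concatMap; allFin; map; filter; upTo)
open import Data.List.Properties using (++-assoc; ++-identityʳ; ∷-injective; ∷-injectiveʳ; tabulate-cong)
open import Data.List.Membership.DecPropositional using () renaming (_∈?_ to ∈?-with)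
open import Data.List.Membership.Propositional using (_∈_; lose)
open import Data.List.Membership.Propositional.Properties
  using ( ∈-tabulate⁺; ∈-tabulate⁻; ∈-concatMap⁺; ∈-concatMap⁻; ∈-allFin; ∈-map⁺; ∈-++⁺ˡ; ∈-++⁺ʳ
        ; ∈-filter⁺; ∈-filter⁻; ∈-upTo⁺)
import Data.List.Relation.Binary.Lex.Strict as Lex
open import Data.List.Relation.Binary.Pointwise using (Pointwise-≡⇒≡; ≡⇒Pointwise-≡)
import Data.List.Relation.Unary.All as All
open import Data.List.Relation.Unary.Any using (here; there; satisfied)
open import Data.List.Relation.Unary.Linked as Linked using (Linked; []; [-]; _∷_)
open import Data.List.Relation.Unary.Linked.Properties using (Linked⇒All)
open import Data.Maybe using (Maybe; just; nothing)
open import Data.Nat using (ℕ; zero; suc; _+_; _<_; _≤_; _≤ᵇ_; z≤n; s≤s; _<?_)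
open import Data.Nat.Binary
  using (ℕᵇ; 2[1+_]; 1+[2_]) renaming (zero to 0ᵇ; fromℕ to toBinary; toℕ to fromBinary)
open import Data.Nat.Binary.Properties using (fromℕ-toℕ)
import Data.Nat.Properties as ℕₚ
open import Data.Product using (Σ; ∃; ∃₂; _×_; _,_; proj₁; proj₂; map₁)
open import Data.Sum using (_⊎_; inj₁; inj₂)
open import Data.Vec using ([]; _∷_; lookup)
open import Data.Vec.Functional using () renaming (_∷_ to _◂_)
open import Effect.Monad using (RawMonad)
open import Function using (_∘_)
open import Function.Bundles using (_⇔_; mk⇔; Equivalence)
open import Relation.Binary.Consequences using (tri⇒dec≈)
open import Level using (0ℓ)
open import Relation.Binary.Core using (Rel)
open import Relation.Binary.Definitions using (Transitive; Trichotomous; tri<; tri≈; tri>)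
open import Relation.Binary.PropositionalEquality
  using (_≡_; _≢_; refl; sym; trans; cong; cong₂; subst; subst₂; _≗_; isEquivalence; module ≡-Reasoning)
open import Relation.Binary.Structures using (IsEquivalence)
open import Relation.Nullary using (¬_; Dec; yes; no; does; ¬¬-excluded-middle; ¬¬-map; decidable-stable)
open import Relation.Nullary.Negation using (¬¬-Monad)

private
  variable
    m a n : ℕ

∧-elim : ∀ {x y} → x ∧ y ≡ true → x ≡ true × y ≡ true
∧-elim {true} {true} refl = refl , refl

∧-intro : ∀ {x y} → x ≡ true → y ≡ true → x ∧ y ≡ true
∧-intro refl refl = refl

∧-not-elim : ∀ {x y} → x ∧ not y ≡ true → x ≡ true × y ≡ false
∧-not-elim x∧¬y = let x≡true , ¬y≡true = ∧-elim x∧¬y in x≡true , not-injective ¬y≡true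

true≢false : true ≢ false
true≢false ()

≢true⇒not≡true : ∀ {x} → x ≢ true → not x ≡ true
≢true⇒not≡true x≢true = cong not (¬-not x≢true)

not≡true⇒≢true : ∀ {x} → not x ≡ true → x ≢ true
not≡true⇒≢true {false} _ ()

≤+≤-≡⇒≡×≡ : ∀ {a b c d} → a ≤ b → c ≤ d → a + c ≡ b + d → a ≡ b × c ≡ d
≤+≤-≡⇒≡×≡ {a} {b} {c} {d} a≤b c≤d sum≡ = a≡b , ℕₚ.+-cancelˡ-≡ a c d (trans sum≡ (cong (_+ d) (sym a≡b)))
  where
  a≡b : a ≡ b
  a≡b = ℕₚ.≤-antisym a≤b
    (ℕₚ.+-cancelʳ-≤ c b a (ℕₚ.≤-trans (ℕₚ.+-monoʳ-≤ b c≤d) (ℕₚ.≤-reflexive (sym sum≡))))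

-- Counting

count-cong : {f g : Fin n → Bool} → f ≗ g → count f ≡ count g
count-cong {zero} f≗g = refl
count-cong {suc n} f≗g rewrite f≗g fzero = cong (_ +_) (count-cong (f≗g ∘ fsuc))

count-split : (f g : Fin n → Bool) →
  count f ≡ count (λ i → f i ∧ g i) + count (λ i → f i ∧ not (g i))
count-split {zero} f g = refl
count-split {suc n} f g with f fzero | g fzero
... | false | _     = count-split (f ∘ fsuc) (g ∘ fsuc)
... | true  | true  = cong suc (count-split (f ∘ fsuc) (g ∘ fsuc))
... | true  | false = trans (cong suc (count-split (f ∘ fsuc) (g ∘ fsuc))) (sym (ℕₚ.+-suc _ _))

count-≤ : (f : Fin n → Bool) → count f ≤ n
count-≤ {zero} f = z≤n
count-≤ {suc n} f with f fzero
... | true  = s≤s (count-≤ (f ∘ fsuc))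
... | false = ℕₚ.m≤n⇒m≤1+n (count-≤ (f ∘ fsuc))

count-∧-≤ : (f g : Fin n → Bool) → count (λ i → f i ∧ g i) ≤ count f
count-∧-≤ {zero} f g = z≤n
count-∧-≤ {suc n} f g with f fzero | g fzero
... | false | _     = count-∧-≤ (f ∘ fsuc) (g ∘ fsuc)
... | true  | true  = s≤s (count-∧-≤ (f ∘ fsuc) (g ∘ fsuc))
... | true  | false = ℕₚ.m≤n⇒m≤1+n (count-∧-≤ (f ∘ fsuc) (g ∘ fsuc))

count-witness : (f : Fin n → Bool) → 0 < count f → ∃ λ i → f i ≡ true
count-witness {suc n} f pos with f fzero in e
... | true  = fzero , e
... | false = let i , fi = count-witness (f ∘ fsuc) pos in fsuc i , fi

witness⇒count-pos : (f : Fin n → Bool) (i : Fin n) → f i ≡ true → 0 < count f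
witness⇒count-pos f fzero fi rewrite fi = s≤s z≤n
witness⇒count-pos {suc n} f (fsuc i) fi with f fzero
... | true  = s≤s z≤n
... | false = witness⇒count-pos (f ∘ fsuc) i fi

count-∧-const : (f : Fin n → Bool) (b : Bool) →
  count (λ i → f i ∧ b) ≡ (if b then count f else 0)
count-∧-const f true = count-cong (∧-identityʳ ∘ f)
count-∧-const {zero} f false = refl
count-∧-const {suc n} f false rewrite ∧-zeroʳ (f fzero) = count-∧-const (f ∘ fsuc) false

empty-or-witness : (f : Fin n → Bool) → count f ≡ 0 ⊎ ∃ λ i → f i ≡ true
empty-or-witness f with count f in c≡
... | zero  = inj₁ refl
... | suc _ = inj₂ (count-witness f (subst (0 <_) (sym c≡) (s≤s z≤n)))

-- Counting along an equivalence relation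

module ClassCounting
  {sF sG ℓ} {_~_ : Rel (Fin sF ⊎ Fin sG) ℓ} (~-isEquivalence : IsEquivalence _~_)
  (inClass : Fin sF → Fin sF ⊎ Fin sG → Bool)
  (inClass⇔ : ∀ f z → inClass f z ≡ true ⇔ z ~ inj₁ f)
  where

  open IsEquivalence ~-isEquivalence renaming (refl to ~-refl; sym to ~-sym; trans to ~-trans)

  private
    Point : Set
    Point = Fin sF ⊎ Fin sG

  Invariant : (Point → Bool) → Set ℓ
  Invariant X = ∀ {z z′} → z ~ z′ → X z ≡ X z′

  classCount : (Fin n → Bool) → (Fin n → Point) → Fin sF → ℕ
  classCount A ι f = count (λ i → A i ∧ inClass f (ι i))

  outside : (Fin n → Bool) → (Fin n → Point) → Fin sF → Fin n → Bool
  outside A ι f₀ i = A i ∧ not (inClass f₀ (ι i))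

  ClassesAgree : (Fin sF → Bool) → (Fin sG → Bool) → Set
  ClassesAgree AF AG = ∀ f → AF f ≡ true → classCount AG inj₂ f ≡ classCount AF inj₁ f

  NonemptyClassesAgree : (Fin sF → Bool) → (Fin sG → Bool) → Set
  NonemptyClassesAgree AF AG =
    ∀ f → AF f ≡ true → 0 < classCount AG inj₂ f → classCount AG inj₂ f ≡ classCount AF inj₁ f

  Covered : (Fin sF → Bool) → (Fin sG → Bool) → Set ℓ
  Covered AF AG = ∀ j → AG j ≡ true → ∃ λ f → AF f ≡ true × inj₂ j ~ inj₁ f

  private
    inClass⇒~ : ∀ {f z} → inClass f z ≡ true → z ~ inj₁ f
    inClass⇒~ = Equivalence.to (inClass⇔ _ _)

    ~⇒inClass : ∀ {f z} → z ~ inj₁ f → inClass f z ≡ true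
    ~⇒inClass = Equivalence.from (inClass⇔ _ _)

  inClass-disjoint : ∀ {f f₀ z} → inClass f₀ (inj₁ f) ≡ false →
    inClass f z ≡ true → inClass f₀ z ≡ false
  inClass-disjoint {f} {f₀} {z} f∉f₀ z∈f = ¬-not λ z∈f₀ → true≢false (trans (sym (f∈f₀ z∈f₀)) f∉f₀)
    where
    f∈f₀ : inClass f₀ z ≡ true → inClass f₀ (inj₁ f) ≡ true
    f∈f₀ z∈f₀ = ~⇒inClass (~-trans (~-sym (inClass⇒~ z∈f)) (inClass⇒~ z∈f₀))

  inClass-same : ∀ {f f₀} z → inClass f₀ (inj₁ f) ≡ true → inClass f z ≡ inClass f₀ z
  inClass-same z f∈f₀ = ⇔→≡ {z = true} (mk⇔
    (λ z∈f → ~⇒inClass (~-trans (inClass⇒~ z∈f) (inClass⇒~ f∈f₀)))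
    (λ z∈f₀ → ~⇒inClass (~-trans (inClass⇒~ z∈f₀) (~-sym (inClass⇒~ f∈f₀)))))

  classCount-resp : (A : Fin n → Bool) (ι : Fin n → Point) {f f₀ : Fin sF} →
    inClass f₀ (inj₁ f) ≡ true → classCount A ι f ≡ classCount A ι f₀
  classCount-resp A ι f∈f₀ = count-cong (λ i → cong (A i ∧_) (inClass-same (ι i) f∈f₀))

  classCount-outside : (A : Fin n → Bool) (ι : Fin n → Point) {f f₀ : Fin sF} →
    inClass f₀ (inj₁ f) ≡ false → classCount (outside A ι f₀) ι f ≡ classCount A ι f
  classCount-outside A ι {f} {f₀} f∉f₀ = count-cong pointwise
    where
    pointwise : ∀ i → outside A ι f₀ i ∧ inClass f (ι i) ≡ A i ∧ inClass f (ι i)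
    pointwise i with inClass f (ι i) in i∈f
    ... | false = trans (∧-zeroʳ _) (sym (∧-zeroʳ (A i)))
    ... | true rewrite inClass-disjoint f∉f₀ i∈f = cong (_∧ true) (∧-identityʳ (A i))

  count-split-class : (A : Fin n → Bool) (ι : Fin n → Point) (f₀ : Fin sF) →
    count A ≡ classCount A ι f₀ + count (outside A ι f₀)
  count-split-class A ι f₀ = count-split A (inClass f₀ ∘ ι)

  count-split-invariant : (A : Fin n → Bool) (ι : Fin n → Point) (f₀ : Fin sF) →
    (X : Point → Bool) → Invariant X →
    count (λ i → A i ∧ X (ι i)) ≡
      (if X (inj₁ f₀) then classCount A ι f₀ else 0) + count (λ i → outside A ι f₀ i ∧ X (ι i))
  count-split-invariant A ι f₀ X X-inv = begin
    count (λ i → A i ∧ X (ι i))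
      ≡⟨ count-split _ (inClass f₀ ∘ ι) ⟩
    count (λ i → (A i ∧ X (ι i)) ∧ inClass f₀ (ι i)) +
    count (λ i → (A i ∧ X (ι i)) ∧ not (inClass f₀ (ι i)))
      ≡⟨ cong₂ _+_ (count-cong inside) (count-cong swap) ⟩
    count (λ i → (A i ∧ inClass f₀ (ι i)) ∧ X (inj₁ f₀)) + count (λ i → outside A ι f₀ i ∧ X (ι i))
      ≡⟨ cong (_+ count (λ i → outside A ι f₀ i ∧ X (ι i)))
              (count-∧-const (λ i → A i ∧ inClass f₀ (ι i)) (X (inj₁ f₀))) ⟩
    (if X (inj₁ f₀) then classCount A ι f₀ else 0) + count (λ i → outside A ι f₀ i ∧ X (ι i)) ∎
    where
    open ≡-Reasoning
    inside : ∀ i → (A i ∧ X (ι i)) ∧ inClass f₀ (ι i) ≡ (A i ∧ inClass f₀ (ι i)) ∧ X (inj₁ f₀)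
    inside i with inClass f₀ (ι i) in i∈f₀
    ... | false = trans (∧-zeroʳ _) (cong (_∧ X (inj₁ f₀)) (sym (∧-zeroʳ (A i))))
    ... | true rewrite X-inv (inClass⇒~ i∈f₀) =
      trans (∧-identityʳ _) (cong (_∧ X (inj₁ f₀)) (sym (∧-identityʳ (A i))))
    swap : ∀ i → (A i ∧ X (ι i)) ∧ not (inClass f₀ (ι i)) ≡ outside A ι f₀ i ∧ X (ι i)
    swap i = begin
      (A i ∧ X (ι i)) ∧ not (inClass f₀ (ι i))   ≡⟨ ∧-assoc (A i) _ _ ⟩
      A i ∧ (X (ι i) ∧ not (inClass f₀ (ι i)))   ≡⟨ cong (A i ∧_) (∧-comm (X (ι i)) _) ⟩
      A i ∧ (not (inClass f₀ (ι i)) ∧ X (ι i))   ≡⟨ sym (∧-assoc (A i) _ _) ⟩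
      outside A ι f₀ i ∧ X (ι i)                  ∎

  private
    classCount-self : (AF : Fin sF → Bool) {f₀ : Fin sF} → AF f₀ ≡ true → 0 < classCount AF inj₁ f₀
    classCount-self AF {f₀} f₀∈AF = witness⇒count-pos _ f₀ (∧-intro f₀∈AF (~⇒inClass ~-refl))

    outside-bound : (AF : Fin sF → Bool) {f₀ : Fin sF} → AF f₀ ≡ true →
      count AF ≤ suc n → count (outside AF inj₁ f₀) ≤ n
    outside-bound AF {f₀} f₀∈AF bound = ℕₚ.≤-pred (ℕₚ.≤-trans
      (ℕₚ.+-monoˡ-≤ (count (outside AF inj₁ f₀)) (classCount-self AF f₀∈AF))
      (subst (_≤ _) (count-split-class AF inj₁ f₀) bound))

    classCount-outside-≡ : (AF : Fin sF → Bool) (AG : Fin sG → Bool) {f f₀ : Fin sF} →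
      outside AF inj₁ f₀ f ≡ true →
      (AF f ≡ true → classCount AG inj₂ f ≡ classCount AF inj₁ f) →
      classCount (outside AG inj₂ f₀) inj₂ f ≡ classCount (outside AF inj₁ f₀) inj₁ f
    classCount-outside-≡ AF AG f∈ classes≡ = let f∈AF , f∉f₀ = ∧-not-elim f∈ in
      trans (classCount-outside AG inj₂ f∉f₀)
        (trans (classes≡ f∈AF) (sym (classCount-outside AF inj₁ f∉f₀)))

  -- Both proofs below remove the class of one point f₀ of AF from AF and AG and recurse.
  count-invariant : (AF : Fin sF → Bool) (AG : Fin sG → Bool) → ClassesAgree AF AG →
    count AG ≡ count AF → (X : Point → Bool) → Invariant X →
    count (λ i → AF i ∧ X (inj₁ i)) ≡ count (λ j → AG j ∧ X (inj₂ j))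
  count-invariant AF AG classes≡ total≡ X X-inv = go (count AF) AF AG ℕₚ.≤-refl classes≡ total≡
    where
    go : ∀ n (AF : Fin sF → Bool) (AG : Fin sG → Bool) → count AF ≤ n → ClassesAgree AF AG →
      count AG ≡ count AF → count (λ i → AF i ∧ X (inj₁ i)) ≡ count (λ j → AG j ∧ X (inj₂ j))
    go n AF AG bound classes≡ total≡ with empty-or-witness AF
    ... | inj₁ AF-empty = trans (empty (count-∧-≤ AF _) AF-empty)
                                (sym (empty (count-∧-≤ AG _) (trans total≡ AF-empty)))
      where
      empty : ∀ {c c′} → c ≤ c′ → c′ ≡ 0 → c ≡ 0
      empty c≤c′ refl = ℕₚ.n≤0⇒n≡0 c≤c′
    go zero AF AG bound _ _ | inj₂ (f₀ , f₀∈AF) =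
      ⊥-elim (ℕₚ.<⇒≱ (witness⇒count-pos AF f₀ f₀∈AF) bound)
    go (suc n) AF AG bound classes≡ total≡ | inj₂ (f₀ , f₀∈AF) = begin
      count (λ i → AF i ∧ X (inj₁ i))
        ≡⟨ count-split-invariant AF inj₁ f₀ X X-inv ⟩
      (if X (inj₁ f₀) then classCount AF inj₁ f₀ else 0) + count (λ i → AF′ i ∧ X (inj₁ i))
        ≡⟨ cong₂ _+_ (cong (λ c → if X (inj₁ f₀) then c else 0) (sym (classes≡ f₀ f₀∈AF)))
                     (go n AF′ AG′ (outside-bound AF f₀∈AF bound) classes′ total′) ⟩
      (if X (inj₁ f₀) then classCount AG inj₂ f₀ else 0) + count (λ j → AG′ j ∧ X (inj₂ j))
        ≡⟨ sym (count-split-invariant AG inj₂ f₀ X X-inv) ⟩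
      count (λ j → AG j ∧ X (inj₂ j)) ∎
      where
      open ≡-Reasoning
      AF′ : Fin sF → Bool
      AF′ = outside AF inj₁ f₀
      AG′ : Fin sG → Bool
      AG′ = outside AG inj₂ f₀
      classes′ : ClassesAgree AF′ AG′
      classes′ f f∈AF′ = classCount-outside-≡ AF AG f∈AF′ (classes≡ f)
      total′ : count AG′ ≡ count AF′
      total′ = ℕₚ.+-cancelˡ-≡ (classCount AF inj₁ f₀) _ _ (begin
        classCount AF inj₁ f₀ + count AG′ ≡⟨ cong (_+ count AG′) (sym (classes≡ f₀ f₀∈AF)) ⟩
        classCount AG inj₂ f₀ + count AG′ ≡⟨ sym (count-split-class AG inj₂ f₀) ⟩
        count AG                           ≡⟨ total≡ ⟩
        count AF                           ≡⟨ count-split-class AF inj₁ f₀ ⟩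
        classCount AF inj₁ f₀ + count AF′  ∎)

  covered-count : (AF : Fin sF → Bool) (AG : Fin sG → Bool) → Covered AF AG → NonemptyClassesAgree AF AG →
    count AG ≤ count AF × (count AG ≡ count AF → ClassesAgree AF AG)
  covered-count AF AG = go (count AF) AF AG ℕₚ.≤-refl
    where
    go : ∀ n (AF : Fin sF → Bool) (AG : Fin sG → Bool) → count AF ≤ n → Covered AF AG →
      NonemptyClassesAgree AF AG → count AG ≤ count AF × (count AG ≡ count AF → ClassesAgree AF AG)
    go n AF AG bound covered classes≡ with empty-or-witness AF
    ... | inj₁ AF-empty = AG-small , λ _ f f∈AF → ⊥-elim (nonempty f∈AF)
      where
      nonempty : ∀ {f} → AF f ≡ true → ⊥
      nonempty f∈AF = ℕₚ.<⇒≢ (witness⇒count-pos AF _ f∈AF) (sym AF-empty)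
      AG-small : count AG ≤ count AF
      AG-small with empty-or-witness AG
      ... | inj₁ AG-empty = ℕₚ.≤-reflexive (trans AG-empty (sym AF-empty))
      ... | inj₂ (j , j∈AG) = ⊥-elim (nonempty (proj₁ (proj₂ (covered j j∈AG))))
    go zero AF AG bound _ _ | inj₂ (f₀ , f₀∈AF) =
      ⊥-elim (ℕₚ.<⇒≱ (witness⇒count-pos AF f₀ f₀∈AF) bound)
    go (suc n) AF AG bound covered classes≡ | inj₂ (f₀ , f₀∈AF) = AG≤AF , AG≡AF⇒classes≡
      where
      AF′ : Fin sF → Bool
      AF′ = outside AF inj₁ f₀
      AG′ : Fin sG → Bool
      AG′ = outside AG inj₂ f₀
      covered′ : Covered AF′ AG′
      covered′ j j∈AG′ = let j∈AG , j∉f₀ = ∧-not-elim j∈AG′ ; f , f∈AF , j~f = covered j j∈AG in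
        f , ∧-intro f∈AF (≢true⇒not≡true λ f∈f₀ →
          true≢false (trans (sym (~⇒inClass (~-trans j~f (inClass⇒~ f∈f₀)))) j∉f₀)) , j~f
      classes′ : NonemptyClassesAgree AF′ AG′
      classes′ f f∈AF′ pos = let f∈AF , f∉f₀ = ∧-not-elim f∈AF′ in
        classCount-outside-≡ AF AG f∈AF′ λ _ →
          classes≡ f f∈AF (subst (0 <_) (classCount-outside AG inj₂ f∉f₀) pos)
      ih : count AG′ ≤ count AF′ × (count AG′ ≡ count AF′ → ClassesAgree AF′ AG′)
      ih = go n AF′ AG′ (outside-bound AF f₀∈AF bound) covered′ classes′
      class₀ : classCount AG inj₂ f₀ ≤ classCount AF inj₁ f₀
      class₀ with classCount AG inj₂ f₀ in c≡
      ... | zero  = z≤n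
      ... | suc _ = ℕₚ.≤-reflexive (trans (sym c≡) (classes≡ f₀ f₀∈AF (subst (0 <_) (sym c≡) (s≤s z≤n))))
      AG≤AF : count AG ≤ count AF
      AG≤AF = subst₂ _≤_ (sym (count-split-class AG inj₂ f₀)) (sym (count-split-class AF inj₁ f₀))
                (ℕₚ.+-mono-≤ class₀ (proj₁ ih))
      AG≡AF⇒classes≡ : count AG ≡ count AF → ClassesAgree AF AG
      AG≡AF⇒classes≡ AG≡AF f f∈AF
        with ≤+≤-≡⇒≡×≡ class₀ (proj₁ ih)
               (trans (sym (count-split-class AG inj₂ f₀)) (trans AG≡AF (count-split-class AF inj₁ f₀)))
           | inClass f₀ (inj₁ f) in f∈f₀?
      ... | class₀≡ , _ | true = trans (classCount-resp AG inj₂ f∈f₀?)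
                                  (trans class₀≡ (sym (classCount-resp AF inj₁ f∈f₀?)))
      ... | _ , rest≡ | false = trans (sym (classCount-outside AG inj₂ f∈f₀?))
          (trans (proj₂ ih rest≡ f (∧-intro f∈AF (cong not f∈f₀?)))
                 (classCount-outside AF inj₁ f∈f₀?))

∈-concatMap-allFin⁺ : {A : Set} (f : Fin n → List A) {y : A} (i : Fin n) →
  y ∈ f i → y ∈ concatMap f (allFin n)
∈-concatMap-allFin⁺ f i y∈ = ∈-concatMap⁺ f {xs = allFin _} (lose (∈-allFin i) y∈)

∈-concatMap-allFin⁻ : {A : Set} (f : Fin n → List A) {y : A} → y ∈ concatMap f (allFin n) → ∃ λ i → y ∈ f i
∈-concatMap-allFin⁻ f y∈ = satisfied (∈-concatMap⁻ f {xs = allFin _} y∈)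

sublists : {A : Set} → List A → List (List A)
sublists [] = [] ∷ []
sublists (x ∷ xs) = map (x ∷_) (sublists xs) ++ sublists xs

filter-∈-sublists : {A : Set} {P : A → Set} (P? : ∀ x → Dec (P x)) (xs : List A) →
  filter P? xs ∈ sublists xs
filter-∈-sublists P? [] = here refl
filter-∈-sublists P? (x ∷ xs) with does (P? x)
... | true  = ∈-++⁺ˡ (∈-map⁺ (x ∷_) (filter-∈-sublists P? xs))
... | false = ∈-++⁺ʳ (map (x ∷_) (sublists xs)) (filter-∈-sublists P? xs)

¬¬-filter : {A : Set} (P : A → Set) (xs : List A) → ¬ ¬ (∃ λ ys → ∀ x → x ∈ ys ⇔ (x ∈ xs × P x))
¬¬-filter P [] ¬filtered = ¬filtered ([] , λ x → mk⇔ (λ ()) (λ ()))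
¬¬-filter {A} P (x ∷ xs) ¬filtered = ¬¬-filter P xs λ (ys , ys⇔) → ¬¬-excluded-middle λ where
    (yes Px) → ¬filtered (x ∷ ys , λ z → mk⇔ (keep-to ys⇔ Px) (keep-from ys⇔))
    (no ¬Px) → ¬filtered (ys , λ z → mk⇔ (drop-to ys⇔) (drop-from ys⇔ ¬Px))
  where
  module _ {ys : List A} (ys⇔ : ∀ z → z ∈ ys ⇔ (z ∈ xs × P z)) {z : A} where
    keep-to : P x → z ∈ x ∷ ys → z ∈ x ∷ xs × P z
    keep-to Px (here refl) = here refl , Px
    keep-to Px (there z∈ys) = let z∈xs , Pz = Equivalence.to (ys⇔ z) z∈ys in there z∈xs , Pz
    keep-from : z ∈ x ∷ xs × P z → z ∈ x ∷ ys
    keep-from (here refl , _) = here refl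
    keep-from (there z∈xs , Pz) = there (Equivalence.from (ys⇔ z) (z∈xs , Pz))
    drop-to : z ∈ ys → z ∈ x ∷ xs × P z
    drop-to z∈ys = let z∈xs , Pz = Equivalence.to (ys⇔ z) z∈ys in there z∈xs , Pz
    drop-from : ¬ P x → z ∈ x ∷ xs × P z → z ∈ ys
    drop-from ¬Px (here refl , Px) = ⊥-elim (¬Px Px)
    drop-from ¬Px (there z∈xs , Pz) = Equivalence.from (ys⇔ z) (z∈xs , Pz)

module StrictSort
  {A : Set} {_<_ : Rel A 0ℓ} (<-trans : Transitive _<_) (compare : Trichotomous _≡_ _<_)
  where

  <-irrefl : ∀ {x} → ¬ x < x
  <-irrefl {x} x<x with compare x x
  ... | tri< _ x≢x _ = x≢x refl
  ... | tri≈ x≮x _ _ = x≮x x<x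
  ... | tri> _ x≢x _ = x≢x refl

  insert : A → List A → List A
  insert x [] = x ∷ []
  insert x (y ∷ ys) with compare x y
  ... | tri< _ _ _ = x ∷ y ∷ ys
  ... | tri≈ _ _ _ = y ∷ ys
  ... | tri> _ _ _ = y ∷ insert x ys

  ∈-insert⁺ˡ : ∀ x ys → x ∈ insert x ys
  ∈-insert⁺ˡ x [] = here refl
  ∈-insert⁺ˡ x (y ∷ ys) with compare x y
  ... | tri< _ _ _ = here refl
  ... | tri≈ _ x≡y _ = here x≡y
  ... | tri> _ _ _ = there (∈-insert⁺ˡ x ys)

  ∈-insert⁺ʳ : ∀ x {z} ys → z ∈ ys → z ∈ insert x ys
  ∈-insert⁺ʳ x (y ∷ ys) z∈ with compare x y | z∈
  ... | tri< _ _ _ | _ = there z∈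
  ... | tri≈ _ _ _ | _ = z∈
  ... | tri> _ _ _ | here z≡y = here z≡y
  ... | tri> _ _ _ | there z∈ys = there (∈-insert⁺ʳ x ys z∈ys)

  ∈-insert⁻ : ∀ x {z} ys → z ∈ insert x ys → z ≡ x ⊎ z ∈ ys
  ∈-insert⁻ x [] (here z≡x) = inj₁ z≡x
  ∈-insert⁻ x (y ∷ ys) z∈ with compare x y | z∈
  ... | tri< _ _ _ | here z≡x = inj₁ z≡x
  ... | tri< _ _ _ | there z∈′ = inj₂ z∈′
  ... | tri≈ _ _ _ | z∈′ = inj₂ z∈′
  ... | tri> _ _ _ | here z≡y = inj₂ (here z≡y)
  ... | tri> _ _ _ | there z∈′ with ∈-insert⁻ x ys z∈′
  ...   | inj₁ z≡x = inj₁ z≡x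
  ...   | inj₂ z∈ys = inj₂ (there z∈ys)

  insert-linked-above : ∀ x {y ys} → y < x → Linked _<_ (y ∷ ys) → Linked _<_ (y ∷ insert x ys)
  insert-linked-above x {ys = []} y<x _ = y<x ∷ [-]
  insert-linked-above x {ys = z ∷ zs} y<x (y<z ∷ sorted) with compare x z
  ... | tri< x<z _ _ = y<x ∷ x<z ∷ sorted
  ... | tri≈ _ _ _ = y<z ∷ sorted
  ... | tri> _ _ z<x = y<z ∷ insert-linked-above x z<x sorted

  insert-linked : ∀ x {ys} → Linked _<_ ys → Linked _<_ (insert x ys)
  insert-linked x {[]} _ = [-]
  insert-linked x {y ∷ ys} sorted with compare x y
  ... | tri< x<y _ _ = x<y ∷ sorted
  ... | tri≈ _ _ _ = sorted
  ... | tri> _ _ y<x = insert-linked-above x y<x sorted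

  canonicalSort : List A → List A
  canonicalSort = foldr insert []

  canonicalSort-linked : ∀ xs → Linked _<_ (canonicalSort xs)
  canonicalSort-linked [] = []
  canonicalSort-linked (x ∷ xs) = insert-linked x (canonicalSort-linked xs)

  ∈-canonicalSort⁺ : ∀ {z} xs → z ∈ xs → z ∈ canonicalSort xs
  ∈-canonicalSort⁺ (x ∷ xs) (here refl) = ∈-insert⁺ˡ x (canonicalSort xs)
  ∈-canonicalSort⁺ (x ∷ xs) (there z∈) = ∈-insert⁺ʳ x (canonicalSort xs) (∈-canonicalSort⁺ xs z∈)

  ∈-canonicalSort⁻ : ∀ {z} xs → z ∈ canonicalSort xs → z ∈ xs
  ∈-canonicalSort⁻ (x ∷ xs) z∈ with ∈-insert⁻ x (canonicalSort xs) z∈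
  ... | inj₁ refl = here refl
  ... | inj₂ z∈′ = there (∈-canonicalSort⁻ xs z∈′)

  private
    head-< : ∀ {x xs z} → Linked _<_ (x ∷ xs) → z ∈ xs → x < z
    head-< (x<y ∷ sorted) = All.lookup (Linked⇒All <-trans x<y sorted)

  linked-unique : ∀ {xs ys} → Linked _<_ xs → Linked _<_ ys → (∀ z → z ∈ xs ⇔ z ∈ ys) → xs ≡ ys
  linked-unique {[]} {[]} _ _ same = refl
  linked-unique {[]} {y ∷ _} _ _ same with Equivalence.from (same y) (here refl)
  ... | ()
  linked-unique {x ∷ _} {[]} _ _ same with Equivalence.to (same x) (here refl)
  ... | ()
  linked-unique {x ∷ xs} {y ∷ ys} xs↗ ys↗ same
    with Equivalence.to (same x) (here refl) | Equivalence.from (same y) (here refl)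
  ... | here refl | _ = cong (x ∷_) (linked-unique (Linked.tail xs↗) (Linked.tail ys↗) same-tails)
    where
    drop-head : ∀ {z zs zs′} → Linked _<_ (x ∷ zs) → z ∈ zs → z ∈ x ∷ zs′ → z ∈ zs′
    drop-head sorted z∈ (here refl) = ⊥-elim (<-irrefl (head-< sorted z∈))
    drop-head sorted z∈ (there z∈′) = z∈′
    same-tails : ∀ z → z ∈ xs ⇔ z ∈ ys
    same-tails z = mk⇔ (λ z∈ → drop-head xs↗ z∈ (Equivalence.to (same z) (there z∈)))
                       (λ z∈ → drop-head ys↗ z∈ (Equivalence.from (same z) (there z∈)))
  ... | there x∈ys | here refl = ⊥-elim (<-irrefl (head-< ys↗ x∈ys))
  ... | there x∈ys | there y∈xs = ⊥-elim (<-irrefl (<-trans (head-< ys↗ x∈ys) (head-< xs↗ y∈xs)))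

-- Canonical order on formulas

module _ {m a : ℕ} where

  encode-++-injective : (φ ψ : Fm m a) {r s : List ℕ} → encode φ ++ r ≡ encode ψ ++ s → φ ≡ ψ × r ≡ s
  encode-++-injective ⊤' ⊤' e = refl , ∷-injectiveʳ e
  encode-++-injective (var p) (var q) e with ∷-injective (∷-injectiveʳ e)
  ... | p≡q , r≡s = cong var (toℕ-injective p≡q) , r≡s
  encode-++-injective (¬' φ) (¬' ψ) e with encode-++-injective φ ψ (∷-injectiveʳ e)
  ... | refl , r≡s = refl , r≡s
  encode-++-injective (φ₁ ∧' φ₂) (ψ₁ ∧' ψ₂) {r} {s} e
    with encode-++-injective φ₁ ψ₁
           (trans (sym (++-assoc (encode φ₁) _ r)) (trans (∷-injectiveʳ e) (++-assoc (encode ψ₁) _ s)))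
  ... | refl , e₂ with encode-++-injective φ₂ ψ₂ e₂
  ... | refl , r≡s = refl , r≡s
  encode-++-injective (◇≥ α k φ) (◇≥ β j ψ) e with ∷-injective (∷-injectiveʳ e)
  ... | α≡β , e₁ with ∷-injective e₁
  ... | refl , e₂ with encode-++-injective φ ψ e₂ | toℕ-injective α≡β
  ... | refl , r≡s | refl = refl , r≡s
  encode-++-injective ⊤' (var _) ()
  encode-++-injective ⊤' (¬' _) ()
  encode-++-injective ⊤' (_ ∧' _) ()
  encode-++-injective ⊤' (◇≥ _ _ _) ()
  encode-++-injective (var _) ⊤' ()
  encode-++-injective (var _) (¬' _) ()
  encode-++-injective (var _) (_ ∧' _) ()
  encode-++-injective (var _) (◇≥ _ _ _) ()
  encode-++-injective (¬' _) ⊤' ()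
  encode-++-injective (¬' _) (var _) ()
  encode-++-injective (¬' _) (_ ∧' _) ()
  encode-++-injective (¬' _) (◇≥ _ _ _) ()
  encode-++-injective (_ ∧' _) ⊤' ()
  encode-++-injective (_ ∧' _) (var _) ()
  encode-++-injective (_ ∧' _) (¬' _) ()
  encode-++-injective (_ ∧' _) (◇≥ _ _ _) ()
  encode-++-injective (◇≥ _ _ _) ⊤' ()
  encode-++-injective (◇≥ _ _ _) (var _) ()
  encode-++-injective (◇≥ _ _ _) (¬' _) ()
  encode-++-injective (◇≥ _ _ _) (_ ∧' _) ()

  encode-injective : {φ ψ : Fm m a} → encode φ ≡ encode ψ → φ ≡ ψ
  encode-injective {φ} {ψ} e = proj₁ (encode-++-injective φ ψ
    (trans (++-identityʳ (encode φ)) (trans e (sym (++-identityʳ (encode ψ))))))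

  ≺-trans : {φ ψ χ : Fm m a} → φ ≺ ψ → ψ ≺ χ → φ ≺ χ
  ≺-trans = Lex.<-transitive isEquivalence ℕₚ.<-resp₂-≡ ℕₚ.<-trans

  ≺-compare : Trichotomous {A = Fm m a} _≡_ _≺_
  ≺-compare φ ψ with Lex.<-compare sym ℕₚ.<-cmp (encode φ) (encode ψ)
  ... | tri< φ≺ψ φ≢ψ ψ⊀φ = tri< φ≺ψ (φ≢ψ ∘ ≡⇒Pointwise-≡ ∘ cong encode) ψ⊀φ
  ... | tri≈ φ⊀ψ φ≡ψ ψ⊀φ = tri≈ φ⊀ψ (encode-injective (Pointwise-≡⇒≡ φ≡ψ)) ψ⊀φ
  ... | tri> φ⊀ψ φ≢ψ ψ≺φ = tri> φ⊀ψ (φ≢ψ ∘ ≡⇒Pointwise-≡ ∘ cong encode) ψ≺φ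

  open StrictSort ≺-trans ≺-compare public

-- Graded modalities, conjunctions and types

succCount : (M : Model m a) → Fin a → Fin (size M) → Fm m a → ℕ
succCount M α w φ = count (λ v → R M α w v ∧ sat M φ v)

module _ (M : Model m a) (α : Fin a) (w : Fin (size M)) (φ : Fm m a) where

  ⊨◇≥⇒≤ : ∀ {k} → M , w ⊨ ◇≥ α k φ → k ≤ succCount M α w φ
  ⊨◇≥⇒≤ = ℕₚ.≤ᵇ⇒≤ _ _ ∘ Equivalence.from T-≡

  ≤⇒⊨◇≥ : ∀ {k} → k ≤ succCount M α w φ → M , w ⊨ ◇≥ α k φ
  ≤⇒⊨◇≥ = Equivalence.to T-≡ ∘ ℕₚ.≤⇒≤ᵇ

  ⊨◇=⇒≡ : ∀ {ℓ} → M , w ⊨ ◇= α ℓ φ → ℓ ≡ succCount M α w φ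
  ⊨◇=⇒≡ ⊨◇= with ∧-elim ⊨◇=
  ... | ⊨◇≥ℓ , ⊭◇≥1+ℓ =
    ℕₚ.≤-antisym (⊨◇≥⇒≤ ⊨◇≥ℓ) (ℕₚ.≮⇒≥ (not≡true⇒≢true ⊭◇≥1+ℓ ∘ ≤⇒⊨◇≥))

  ≡⇒⊨◇= : ∀ {ℓ} → ℓ ≡ succCount M α w φ → M , w ⊨ ◇= α ℓ φ
  ≡⇒⊨◇= refl = ∧-intro (≤⇒⊨◇≥ ℕₚ.≤-refl)
    (≢true⇒not≡true (ℕₚ.<-irrefl refl ∘ ⊨◇≥⇒≤))

succCount-⊤ : (M : Model m a) (α : Fin a) (w : Fin (size M)) → succCount M α w ⊤' ≡ deg M α w
succCount-⊤ M α w = count-cong (∧-identityʳ ∘ R M α w)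

module _ {m a : ℕ} {M : Model m a} {w : Fin (size M)} where

  ⊨conj⁻ : ∀ {χ} (L : List (Fm m a)) → M , w ⊨ conj L → χ ∈ L → M , w ⊨ χ
  ⊨conj⁻ (_ ∷ []) ⊨L (here refl) = ⊨L
  ⊨conj⁻ (_ ∷ _ ∷ _) ⊨L (here refl) = proj₁ (∧-elim ⊨L)
  ⊨conj⁻ (_ ∷ L@(_ ∷ _)) ⊨L (there χ∈) = ⊨conj⁻ L (proj₂ (∧-elim ⊨L)) χ∈

  ⊨conj⁺ : (L : List (Fm m a)) → (∀ χ → χ ∈ L → M , w ⊨ χ) → M , w ⊨ conj L
  ⊨conj⁺ [] _ = refl
  ⊨conj⁺ (χ ∷ []) ⊨all = ⊨all χ (here refl)
  ⊨conj⁺ (χ ∷ L@(_ ∷ _)) ⊨all = ∧-intro (⊨all χ (here refl)) (⊨conj⁺ L (λ ψ → ⊨all ψ ∘ there))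

  ⊨IsConjOf⁻ : ∀ {C φ χ} → IsConjOf C φ → M , w ⊨ φ → C χ → M , w ⊨ χ
  ⊨IsConjOf⁻ (L , _ , L⇔C , refl) ⊨φ Cχ = ⊨conj⁻ L ⊨φ (Equivalence.from (L⇔C _) Cχ)

  ⊨IsConjOf⁺ : ∀ {C φ} → IsConjOf C φ → (∀ χ → C χ → M , w ⊨ χ) → M , w ⊨ φ
  ⊨IsConjOf⁺ (L , _ , L⇔C , refl) ⊨C = ⊨conj⁺ L (λ χ → ⊨C χ ∘ Equivalence.to (L⇔C χ))

module _ {m a : ℕ} where

  md-conj≤ : (L : List (Fm m a)) → (∀ χ → χ ∈ L → md χ ≤ n) → md (conj L) ≤ n
  md-conj≤ [] _ = z≤n
  md-conj≤ (χ ∷ []) bound = bound χ (here refl)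
  md-conj≤ (χ ∷ L@(_ ∷ _)) bound = ℕₚ.⊔-lub (bound χ (here refl)) (md-conj≤ L (λ ψ → bound ψ ∘ there))

  md-IsConjOf≤ : ∀ {C φ} → IsConjOf {m} {a} C φ → (∀ χ → C χ → md χ ≤ n) → md φ ≤ n
  md-IsConjOf≤ (L , _ , L⇔C , refl) bound = md-conj≤ L (λ χ → bound χ ∘ Equivalence.to (L⇔C χ))

  md-◇=≤ : ∀ α ℓ (φ : Fm m a) → md φ ≤ n → md (◇= α ℓ φ) ≤ suc n
  md-◇=≤ _ _ _ bound = ℕₚ.⊔-lub (s≤s bound) (s≤s bound)

  IsConjOf-unique : ∀ {C : Fm m a → Set} {φ ψ} → IsConjOf C φ → IsConjOf C ψ → φ ≡ ψ
  IsConjOf-unique (L , L↗ , L⇔C , refl) (L′ , L′↗ , L′⇔C , refl) = cong conj (linked-unique L↗ L′↗ λ χ →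
    mk⇔ (Equivalence.from (L′⇔C χ) ∘ Equivalence.to (L⇔C χ))
        (Equivalence.from (L⇔C χ) ∘ Equivalence.to (L′⇔C χ)))

  IsConjOf-resp : ∀ {C C′ : Fm m a → Set} {φ} → (∀ χ → C χ ⇔ C′ χ) → IsConjOf C φ → IsConjOf C′ φ
  IsConjOf-resp C⇔C′ (L , L↗ , L⇔C , φ≡) = L , L↗ , (λ χ →
    mk⇔ (Equivalence.to (C⇔C′ χ) ∘ Equivalence.to (L⇔C χ))
        (Equivalence.from (L⇔C χ) ∘ Equivalence.from (C⇔C′ χ))) , φ≡

  canonicalSort-IsConjOf : ∀ {C : Fm m a → Set} φs → (∀ χ → χ ∈ φs ⇔ C χ) →
    IsConjOf C (conj (canonicalSort φs))
  canonicalSort-IsConjOf φs φs⇔C = canonicalSort φs , canonicalSort-linked φs , (λ χ →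
    mk⇔ (Equivalence.to (φs⇔C χ) ∘ ∈-canonicalSort⁻ φs)
        (∈-canonicalSort⁺ φs ∘ Equivalence.from (φs⇔C χ))) , refl

  ⊨τε : (M : Model m a) (w : Fin (size M)) → M , w ⊨ τε M w
  ⊨τε M w = ⊨conj⁺ _ λ χ χ∈ → case-lit (∈-tabulate⁻ χ∈)
    where
    case-lit : ∀ {χ} → (∃ λ p → χ ≡ lit M w p) → M , w ⊨ χ
    case-lit (p , refl) with V M p w in Vpw
    ... | true  = Vpw
    ... | false = cong not Vpw

  ⊨τε⇒V≡ : ∀ {M M′ : Model m a} {w w′} → M′ , w′ ⊨ τε M w → ∀ p → V M′ p w′ ≡ V M p w
  ⊨τε⇒V≡ {M} {M′} {w} {w′} ⊨τε p with ⊨conj⁻ {M = M′} _ ⊨τε (∈-tabulate⁺ {f = lit M w} p)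
  ... | ⊨lit with V M p w
  ...   | true  = ⊨lit
  ...   | false = not-injective ⊨lit

  ⊨τε⇒τε≡ : ∀ {M M′ : Model m a} {w w′} → M′ , w′ ⊨ τε M w → τε M w ≡ τε M′ w′
  ⊨τε⇒τε≡ {M} {M′} {w} {w′} ⊨τε = cong conj (tabulate-cong λ p →
    cong (λ b → if b then var p else ¬' var p) (sym (⊨τε⇒V≡ {M} {M′} ⊨τε p)))

  md-τε : (M : Model m a) (w : Fin (size M)) → md (τε M w) ≤ 0
  md-τε M w = md-conj≤ _ λ χ χ∈ → md-lit (∈-tabulate⁻ χ∈)
    where
    md-lit : ∀ {χ} → (∃ λ p → χ ≡ lit M w p) → md χ ≤ 0
    md-lit (p , refl) with V M p w
    ... | true  = z≤n
    ... | false = z≤n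

  -- A copy of the predicate local to IsTypeOf, so that IsTypeOf (k₀ ∷ ks) M w unfolds to
  -- IsConjOf (Conjunct k₀ ks M w).
  Conjunct : (Fin a → ℕ) → Width a n → (M : Model m a) → Fin (size M) → Fm m a → Set
  Conjunct k₀ ks M w χ =
      (χ ≡ τε M w)
    ⊎ (Σ (Fin a) λ α → Σ ℕ λ ℓ → Σ (Fm m a) λ τ →
         1 ≤ ℓ × suc ℓ ≤ k₀ α × InT ks τ × (M , w ⊨ ◇= α ℓ τ) × χ ≡ ◇= α ℓ τ)
    ⊎ (Σ (Fin a) λ α → Σ (Fm m a) λ τ →
         InT ks τ × (M , w ⊨ ◇≥ α (k₀ α) τ) × χ ≡ ◇≥ α (k₀ α) τ)
    ⊎ (Σ (Fin a) λ α → deg M α w < k₀ α × χ ≡ ◇= α (deg M α w) ⊤')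

  Conjunct⇒⊨ : ∀ {k₀} (ks : Width a n) {M w χ} → Conjunct k₀ ks M w χ → M , w ⊨ χ
  Conjunct⇒⊨ ks {M} {w} (inj₁ refl) = ⊨τε M w
  Conjunct⇒⊨ ks (inj₂ (inj₁ (_ , _ , _ , _ , _ , _ , ⊨χ , refl))) = ⊨χ
  Conjunct⇒⊨ ks (inj₂ (inj₂ (inj₁ (_ , _ , _ , ⊨χ , refl)))) = ⊨χ
  Conjunct⇒⊨ ks {M} {w} (inj₂ (inj₂ (inj₂ (α , _ , refl)))) = ≡⇒⊨◇= M α w ⊤' (sym (succCount-⊤ M α w))

  IsTypeOf⇒⊨ : (ks : Width a n) {M : Model m a} {w : Fin (size M)} {τ : Fm m a} →
    IsTypeOf ks M w τ → M , w ⊨ τ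
  IsTypeOf⇒⊨ [] {M} {w} refl = ⊨τε M w
  IsTypeOf⇒⊨ (k₀ ∷ ks) τ-type = ⊨IsConjOf⁺ τ-type λ _ → Conjunct⇒⊨ ks

  IsTypeOf⇒md≤ : (ks : Width a n) {M : Model m a} {w : Fin (size M)} {τ : Fm m a} →
    IsTypeOf ks M w τ → md τ ≤ n
  IsTypeOf⇒md≤ [] {M} {w} refl = md-τε M w
  IsTypeOf⇒md≤ {n = suc n} (k₀ ∷ ks) {M} {w} τ-type = md-IsConjOf≤ τ-type md-Conjunct
    where
    md-Conjunct : ∀ χ → Conjunct k₀ ks M w χ → md χ ≤ suc n
    md-Conjunct χ (inj₁ refl) = ℕₚ.≤-trans (md-τε M w) z≤n
    md-Conjunct χ (inj₂ (inj₁ (α , ℓ , σ , _ , _ , (_ , _ , σ-type) , _ , refl))) =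
      md-◇=≤ α ℓ σ (IsTypeOf⇒md≤ ks σ-type)
    md-Conjunct χ (inj₂ (inj₂ (inj₁ (_ , _ , (_ , _ , σ-type) , _ , refl)))) = s≤s (IsTypeOf⇒md≤ ks σ-type)
    md-Conjunct χ (inj₂ (inj₂ (inj₂ (α , _ , refl)))) = s≤s z≤n

  ModalEquiv : ℕ → (M : Model m a) → Fin (size M) → (M′ : Model m a) → Fin (size M′) → Set
  ModalEquiv n M w M′ w′ = ∀ φ → md φ ≤ n → sat M φ w ≡ sat M′ φ w′

  module _ {M M′ : Model m a} {w : Fin (size M)} {w′ : Fin (size M′)} where

    ModalEquiv-sym : ModalEquiv n M w M′ w′ → ModalEquiv n M′ w′ M w
    ModalEquiv-sym w≡w′ φ bound = sym (w≡w′ φ bound)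

    ModalEquiv⇒⊨ : ModalEquiv n M w M′ w′ → ∀ φ → md φ ≤ n → M , w ⊨ φ → M′ , w′ ⊨ φ
    ModalEquiv⇒⊨ w≡w′ φ bound ⊨φ = trans (sym (w≡w′ φ bound)) ⊨φ

    ModalEquiv⇒τε≡ : ModalEquiv n M w M′ w′ → τε M w ≡ τε M′ w′
    ModalEquiv⇒τε≡ w≡w′ =
      ⊨τε⇒τε≡ {M} {M′} (ModalEquiv⇒⊨ w≡w′ (τε M w) (ℕₚ.≤-trans (md-τε M w) z≤n) (⊨τε M w))

    ModalEquiv⇒deg≡ : ModalEquiv (suc n) M w M′ w′ → ∀ α → deg M α w ≡ deg M′ α w′
    ModalEquiv⇒deg≡ w≡w′ α = trans
      (⊨◇=⇒≡ M′ α w′ ⊤' (ModalEquiv⇒⊨ w≡w′ (◇= α (deg M α w) ⊤') (s≤s z≤n)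
        (≡⇒⊨◇= M α w ⊤' (sym (succCount-⊤ M α w)))))
      (succCount-⊤ M′ α w′)

    Conjunct-transfer : ∀ {k₀} {ks : Width a n} {χ} → ModalEquiv (suc n) M w M′ w′ →
      Conjunct k₀ ks M w χ → Conjunct k₀ ks M′ w′ χ
    Conjunct-transfer w≡w′ (inj₁ χ≡τε) = inj₁ (trans χ≡τε (ModalEquiv⇒τε≡ w≡w′))
    Conjunct-transfer {ks = ks} w≡w′
      (inj₂ (inj₁ (α , ℓ , τ , 1≤ℓ , ℓ<k , τ∈T@(_ , _ , τ-type) , ⊨χ , refl))) =
      inj₂ (inj₁ (α , ℓ , τ , 1≤ℓ , ℓ<k , τ∈T ,
        ModalEquiv⇒⊨ w≡w′ (◇= α ℓ τ) (md-◇=≤ α ℓ τ (IsTypeOf⇒md≤ ks τ-type)) ⊨χ , refl))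
    Conjunct-transfer {k₀ = k₀} {ks = ks} w≡w′
      (inj₂ (inj₂ (inj₁ (α , τ , τ∈T@(_ , _ , τ-type) , ⊨χ , refl)))) =
      inj₂ (inj₂ (inj₁ (α , τ , τ∈T ,
        ModalEquiv⇒⊨ w≡w′ (◇≥ α (k₀ α) τ) (s≤s (IsTypeOf⇒md≤ ks τ-type)) ⊨χ , refl)))
    Conjunct-transfer {k₀ = k₀} w≡w′ (inj₂ (inj₂ (inj₂ (α , deg<k , refl)))) =
      inj₂ (inj₂ (inj₂ (α , subst (_< k₀ α) deg≡ deg<k , cong (λ d → ◇= α d ⊤') deg≡)))
      where
      deg≡ : deg M α w ≡ deg M′ α w′
      deg≡ = ModalEquiv⇒deg≡ w≡w′ α

  IsTypeOf-transfer : (ks : Width a n) {M M′ : Model m a} {w : Fin (size M)} {w′ : Fin (size M′)}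
    {τ : Fm m a} →
    ModalEquiv n M w M′ w′ → IsTypeOf ks M w τ → IsTypeOf ks M′ w′ τ
  IsTypeOf-transfer [] w≡w′ τ≡τε = trans τ≡τε (ModalEquiv⇒τε≡ w≡w′)
  IsTypeOf-transfer (k₀ ∷ ks) w≡w′ = IsConjOf-resp λ χ →
    mk⇔ (Conjunct-transfer w≡w′) (Conjunct-transfer (ModalEquiv-sym w≡w′))

-- Canonical full types

module _ {m a : ℕ} where

  mutual
    fullType : ℕ → (M : Model m a) → Fin (size M) → Fm m a
    fullType zero M w = τε M w
    fullType (suc d) M w = conj (canonicalSort (fullTypeConjuncts d M w))

    fullTypeConjuncts : ℕ → (M : Model m a) → Fin (size M) → List (Fm m a)
    fullTypeConjuncts d M w =
      τε M w ∷ concatMap (λ α → ◇= α (deg M α w) ⊤' ∷ successorConjuncts d M α w) (allFin a)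

    successorConjuncts : ℕ → (M : Model m a) → Fin a → Fin (size M) → List (Fm m a)
    successorConjuncts d M α w = concatMap
      (λ v → if R M α w v then successorConjunct d M α w v ∷ [] else [])
      (allFin (size M))

    successorConjunct : ℕ → (M : Model m a) → Fin a → Fin (size M) → Fin (size M) → Fm m a
    successorConjunct d M α w v = ◇= α (succCount M α w (fullType d M v)) (fullType d M v)

  data FullTypeConjunct (d : ℕ) (M : Model m a) (w : Fin (size M)) : Fm m a → Set where
    valuation : FullTypeConjunct d M w (τε M w)
    degree    : ∀ α → FullTypeConjunct d M w (◇= α (deg M α w) ⊤')
    successor : ∀ α v → R M α w v ≡ true → FullTypeConjunct d M w (successorConjunct d M α w v)

  ∈-fullTypeConjuncts⇔ : ∀ d (M : Model m a) w χ → χ ∈ fullTypeConjuncts d M w ⇔ FullTypeConjunct d M w χ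
  ∈-fullTypeConjuncts⇔ d M w χ = mk⇔ to from
    where
    perα : Fin a → List (Fm m a)
    perα α = ◇= α (deg M α w) ⊤' ∷ successorConjuncts d M α w
    perv : Fin a → Fin (size M) → List (Fm m a)
    perv α v = if R M α w v then successorConjunct d M α w v ∷ [] else []
    to : χ ∈ fullTypeConjuncts d M w → FullTypeConjunct d M w χ
    to (here refl) = valuation
    to (there χ∈) with ∈-concatMap-allFin⁻ perα χ∈
    ... | α , here refl = degree α
    ... | α , there χ∈′ with ∈-concatMap-allFin⁻ (perv α) χ∈′
    ...   | v , χ∈″ with R M α w v in Rwv
    ...     | true with χ∈″
    ...       | here refl = successor α v Rwv
    from : FullTypeConjunct d M w χ → χ ∈ fullTypeConjuncts d M w
    from valuation = here refl
    from (degree α) = there (∈-concatMap-allFin⁺ perα α (here refl))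
    from (successor α v Rwv) =
      there (∈-concatMap-allFin⁺ perα α (there (∈-concatMap-allFin⁺ (perv α) v ∈perv)))
      where
      ∈perv : successorConjunct d M α w v ∈ perv α v
      ∈perv rewrite Rwv = here refl

  fullType-IsConjOf : ∀ d (M : Model m a) w → IsConjOf (FullTypeConjunct d M w) (fullType (suc d) M w)
  fullType-IsConjOf d M w = canonicalSort-IsConjOf (fullTypeConjuncts d M w) (∈-fullTypeConjuncts⇔ d M w)

  module _ (d : ℕ) (M : Model m a) (w : Fin (size M)) {M′ : Model m a} {x : Fin (size M′)} where

    ⊨fullType⁻ : M′ , x ⊨ fullType (suc d) M w → ∀ {χ} → FullTypeConjunct d M w χ → M′ , x ⊨ χ
    ⊨fullType⁻ ⊨τ = ⊨IsConjOf⁻ (fullType-IsConjOf d M w) ⊨τ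

    ⊨fullType⁺ : (∀ χ → FullTypeConjunct d M w χ → M′ , x ⊨ χ) → M′ , x ⊨ fullType (suc d) M w
    ⊨fullType⁺ = ⊨IsConjOf⁺ (fullType-IsConjOf d M w)

  ⊨fullType⇒⊨τε : ∀ d (M : Model m a) w {M′ : Model m a} {x} → M′ , x ⊨ fullType d M w → M′ , x ⊨ τε M w
  ⊨fullType⇒⊨τε zero M w ⊨τ = ⊨τ
  ⊨fullType⇒⊨τε (suc d) M w ⊨τ = ⊨fullType⁻ d M w ⊨τ valuation

  ⊨fullType : ∀ d (M : Model m a) w → M , w ⊨ fullType d M w
  ⊨fullType zero M w = ⊨τε M w
  ⊨fullType (suc d) M w = ⊨fullType⁺ d M w λ where
    _ valuation → ⊨τε M w
    _ (degree α) → ≡⇒⊨◇= M α w ⊤' (sym (succCount-⊤ M α w))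
    _ (successor α v _) → ≡⇒⊨◇= M α w (fullType d M v) refl

  md-fullType≤ : ∀ d (M : Model m a) w → md (fullType d M w) ≤ d
  md-fullType≤ zero M w = md-τε M w
  md-fullType≤ (suc d) M w = md-IsConjOf≤ (fullType-IsConjOf d M w) λ where
    _ valuation → ℕₚ.≤-trans (md-τε M w) z≤n
    _ (degree α) → s≤s z≤n
    _ (successor α v _) → md-◇=≤ α (succCount M α w (fullType d M v)) (fullType d M v) (md-fullType≤ d M v)

  Agreement : ℕ → Set
  Agreement d = ∀ (M M′ : Model m a) v v′ → M′ , v′ ⊨ fullType d M v → ModalEquiv d M v M′ v′

  module DepthClasses (d : ℕ) (M M′ : Model m a) where

    Point : Set
    Point = Fin (size M) ⊎ Fin (size M′)

    satAt : Fm m a → Point → Bool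
    satAt φ (inj₁ v) = sat M φ v
    satAt φ (inj₂ v′) = sat M′ φ v′

    _≈_ : Rel Point 0ℓ
    z ≈ z′ = ∀ φ → md φ ≤ d → satAt φ z ≡ satAt φ z′

    ≈-isEquivalence : IsEquivalence _≈_
    ≈-isEquivalence = record
      { refl = λ _ _ → refl
      ; sym = λ z≈z′ φ bound → sym (z≈z′ φ bound)
      ; trans = λ z≈z′ z′≈z″ φ bound → trans (z≈z′ φ bound) (z′≈z″ φ bound)
      }

    inClass : Fin (size M) → Point → Bool
    inClass x = satAt (fullType d M x)

    inClass⇔ : Agreement d → ∀ x z → inClass x z ≡ true ⇔ z ≈ inj₁ x
    inClass⇔ agree x z = mk⇔ (to z) from
      where
      to : ∀ z → inClass x z ≡ true → z ≈ inj₁ x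
      to (inj₁ v) ⊨τ φ bound = sym (agree M M x v ⊨τ φ bound)
      to (inj₂ v′) ⊨τ φ bound = sym (agree M M′ x v′ ⊨τ φ bound)
      from : z ≈ inj₁ x → inClass x z ≡ true
      from z≈x = trans (z≈x (fullType d M x) (md-fullType≤ d M x)) (⊨fullType d M x)

  -- The successors of v and v′ are matched class by class: fullType (suc d) M v fixes
  -- the size of every class and the total number of successors.
  succCount-agree : ∀ d → Agreement d → ∀ (M M′ : Model m a) v v′ → M′ , v′ ⊨ fullType (suc d) M v →
    ∀ α φ → md φ ≤ d → succCount M α v φ ≡ succCount M′ α v′ φ
  succCount-agree d agree M M′ v v′ ⊨τ α φ bound =
    count-invariant (R M α v) (R M′ α v′) classes≡ total≡ (satAt φ) (λ z≈z′ → z≈z′ φ bound)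
    where
    open DepthClasses d M M′
    open ClassCounting ≈-isEquivalence inClass (inClass⇔ agree)
    classes≡ : ∀ x → R M α v x ≡ true → classCount (R M′ α v′) inj₂ x ≡ classCount (R M α v) inj₁ x
    classes≡ x Rvx = sym (⊨◇=⇒≡ M′ α v′ (fullType d M x) (⊨fullType⁻ d M v ⊨τ (successor α x Rvx)))
    total≡ : deg M′ α v′ ≡ deg M α v
    total≡ = sym (trans (⊨◇=⇒≡ M′ α v′ ⊤' (⊨fullType⁻ d M v ⊨τ (degree α))) (succCount-⊤ M′ α v′))

  fullType-agree : ∀ d → Agreement d
  fullType-agree d M M′ v v′ ⊨τ ⊤' _ = refl
  fullType-agree d M M′ v v′ ⊨τ (var p) _ = sym (⊨τε⇒V≡ {M = M} {M′ = M′} (⊨fullType⇒⊨τε d M v ⊨τ) p)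
  fullType-agree d M M′ v v′ ⊨τ (¬' φ) bound = cong not (fullType-agree d M M′ v v′ ⊨τ φ bound)
  fullType-agree d M M′ v v′ ⊨τ (φ ∧' ψ) bound = cong₂ _∧_
    (fullType-agree d M M′ v v′ ⊨τ φ (ℕₚ.m⊔n≤o⇒m≤o (md φ) (md ψ) bound))
    (fullType-agree d M M′ v v′ ⊨τ ψ (ℕₚ.m⊔n≤o⇒n≤o (md φ) (md ψ) bound))
  fullType-agree (suc d) M M′ v v′ ⊨τ (◇≥ α k φ) (s≤s bound) =
    cong (k ≤ᵇ_) (succCount-agree d (fullType-agree d) M M′ v v′ ⊨τ α φ bound)

-- Types of constant width

constWidth : ℕ → (d : ℕ) → Width a d
constWidth K zero = []
constWidth K (suc d) = (λ _ → K) ∷ constWidth K d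

lookup-constWidth : ∀ K d (i : Fin d) (α : Fin a) → lookup (constWidth K d) i α ≡ K
lookup-constWidth K (suc d) fzero α = refl
lookup-constWidth K (suc d) (fsuc i) α = lookup-constWidth K d i α

module _ {m a : ℕ} where

  _≟ᶠ_ : (φ ψ : Fm m a) → Dec (φ ≡ ψ)
  _≟ᶠ_ = tri⇒dec≈ ≺-compare

  -- The conjuncts at (M, w) of a type of width constWidth K (suc d) all lie in the finite list
  -- candidateConjuncts d M w, so such a type can be assembled (classically) by filtering it.
  module Candidates (K : ℕ) where

    modalCandidates : Fin a → Fm m a → List (Fm m a)
    modalCandidates α σ = ◇≥ α K σ ∷ map (λ ℓ → ◇= α ℓ σ) (upTo K)

    mutual
      candidateTypes : ℕ → (M : Model m a) → Fin (size M) → List (Fm m a)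
      candidateTypes zero M v = τε M v ∷ []
      candidateTypes (suc d) M v = map (conj ∘ canonicalSort) (sublists (candidateConjuncts d M v))

      candidateConjuncts : ℕ → (M : Model m a) → Fin (size M) → List (Fm m a)
      candidateConjuncts d M w =
        τε M w ∷ concatMap (λ α → ◇= α (deg M α w) ⊤' ∷ successorCandidates d M α w) (allFin a)

      successorCandidates : ℕ → (M : Model m a) → Fin a → Fin (size M) → List (Fm m a)
      successorCandidates d M α w = concatMap
        (λ v → if R M α w v then concatMap (modalCandidates α) (candidateTypes d M v) else [])
        (allFin (size M))

    ∈-candidateConjuncts-successor : ∀ d (M : Model m a) α w v {σ χ} → R M α w v ≡ true →
      σ ∈ candidateTypes d M v → χ ∈ modalCandidates α σ → χ ∈ candidateConjuncts d M w
    ∈-candidateConjuncts-successor d M α w v {σ} {χ} Rwv σ∈ χ∈ =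
      there (∈-concatMap-allFin⁺ _ α (there (∈-concatMap-allFin⁺ _ v ∈successor)))
      where
      ∈successor : χ ∈ (if R M α w v then concatMap (modalCandidates α) (candidateTypes d M v) else [])
      ∈successor rewrite Rwv = ∈-concatMap⁺ (modalCandidates α) (lose σ∈ χ∈)

    ∈-candidateConjuncts-degree : ∀ d (M : Model m a) α w → ◇= α (deg M α w) ⊤' ∈ candidateConjuncts d M w
    ∈-candidateConjuncts-degree d M α w = there (∈-concatMap-allFin⁺ _ α (here refl))

    module _ (1≤K : 1 ≤ K) where

      mutual
        Conjunct⇒∈candidateConjuncts : ∀ d {M₀ : Model m a} {w₀ χ} →
          Conjunct (λ _ → K) (constWidth K d) M₀ w₀ χ →
          ∀ (M : Model m a) v → M , v ⊨ χ → χ ∈ candidateConjuncts d M v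
        Conjunct⇒∈candidateConjuncts d {M₀} (inj₁ refl) M v ⊨χ
          rewrite ⊨τε⇒τε≡ {M = M₀} {M′ = M} ⊨χ = here refl
        Conjunct⇒∈candidateConjuncts d
          (inj₂ (inj₁ (α , ℓ , σ , 1≤ℓ , ℓ<K , (_ , _ , σ-type) , _ , refl))) M v ⊨χ =
          let x , x∈ = count-witness _ (subst (0 <_) (⊨◇=⇒≡ M α v σ ⊨χ) 1≤ℓ)
              Rvx , ⊨σ = ∧-elim x∈
          in ∈-candidateConjuncts-successor d M α v x Rvx (IsTypeOf⇒∈candidateTypes d σ-type M x ⊨σ)
               (there (∈-map⁺ (λ ℓ → ◇= α ℓ σ) (∈-upTo⁺ ℓ<K)))
        Conjunct⇒∈candidateConjuncts d (inj₂ (inj₂ (inj₁ (α , σ , (_ , _ , σ-type) , _ , refl)))) M v ⊨χ =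
          let x , x∈ = count-witness _ (ℕₚ.≤-trans 1≤K (⊨◇≥⇒≤ M α v σ ⊨χ))
              Rvx , ⊨σ = ∧-elim x∈
          in ∈-candidateConjuncts-successor d M α v x Rvx (IsTypeOf⇒∈candidateTypes d σ-type M x ⊨σ)
               (here refl)
        Conjunct⇒∈candidateConjuncts d (inj₂ (inj₂ (inj₂ (α , _ , refl)))) M v ⊨χ =
          subst (λ k → ◇= α k ⊤' ∈ candidateConjuncts d M v)
            (sym (trans (⊨◇=⇒≡ M α v ⊤' ⊨χ) (succCount-⊤ M α v))) (∈-candidateConjuncts-degree d M α v)

        IsTypeOf⇒∈candidateTypes : ∀ d {M₀ : Model m a} {w₀ σ} → IsTypeOf (constWidth K d) M₀ w₀ σ →
          ∀ (M : Model m a) v → M , v ⊨ σ → σ ∈ candidateTypes d M v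
        IsTypeOf⇒∈candidateTypes zero {M₀} refl M v ⊨σ rewrite ⊨τε⇒τε≡ {M = M₀} {M′ = M} ⊨σ = here refl
        IsTypeOf⇒∈candidateTypes (suc d) {M₀} {w₀} (L , L↗ , L⇔ , refl) M v ⊨σ =
          subst (_∈ candidateTypes (suc d) M v) (cong conj sorted≡L)
            (∈-map⁺ (conj ∘ canonicalSort) (filter-∈-sublists ∈L? (candidateConjuncts d M v)))
          where
          ∈L? : ∀ χ → Dec (χ ∈ L)
          ∈L? χ = ∈?-with _≟ᶠ_ χ L
          candidates : List (Fm m a)
          candidates = filter ∈L? (candidateConjuncts d M v)
          sorted≡L : canonicalSort candidates ≡ L
          sorted≡L = linked-unique (canonicalSort-linked candidates) L↗ λ χ → mk⇔
            (proj₂ ∘ ∈-filter⁻ ∈L? ∘ ∈-canonicalSort⁻ candidates)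
            (λ χ∈L → ∈-canonicalSort⁺ candidates (∈-filter⁺ ∈L?
              (Conjunct⇒∈candidateConjuncts d {M₀} {w₀} (Equivalence.to (L⇔ χ) χ∈L) M v (⊨conj⁻ L ⊨σ χ∈L))
              χ∈L))

      type-exists : ∀ d (M : Model m a) w → ¬ ¬ (∃ λ τ → IsTypeOf (constWidth K d) M w τ)
      type-exists zero M w ¬type = ¬type (τε M w , refl)
      type-exists (suc d) M w = ¬¬-map type (¬¬-filter C (candidateConjuncts d M w))
        where
        C : Fm m a → Set
        C = Conjunct (λ _ → K) (constWidth K d) M w
        type : (∃ λ ys → ∀ χ → χ ∈ ys ⇔ (χ ∈ candidateConjuncts d M w × C χ)) →
          ∃ λ τ → IsTypeOf (constWidth K (suc d)) M w τ
        type (ys , ys⇔) = conj (canonicalSort ys) , canonicalSort-IsConjOf ys λ χ → mk⇔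
          (proj₂ ∘ Equivalence.to (ys⇔ χ))
          (λ c → Equivalence.from (ys⇔ χ)
            (Conjunct⇒∈candidateConjuncts d {M} {w} c M w (Conjunct⇒⊨ (constWidth K d) c) , c))

  DegreeBound : ℕ → Model m a → Set
  DegreeBound K M = ∀ α v → deg M α v < K

  module _ (K : ℕ) (1≤K : 1 ≤ K) (M : Model m a) (bounded : DegreeBound K M) where

    succCount<K : ∀ α w σ → succCount M α w σ < K
    succCount<K α w σ = ℕₚ.≤-<-trans (count-∧-≤ (R M α w) _) (bounded α w)

    ⊭◇≥K : ∀ α w σ → ¬ (M , w ⊨ ◇≥ α K σ)
    ⊭◇≥K α w σ ⊨◇≥ = ℕₚ.<⇒≱ (succCount<K α w σ) (⊨◇≥⇒≤ M α w σ ⊨◇≥)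

    FullTypeIsType : ℕ → Set
    FullTypeIsType d = ∀ w → IsTypeOf (constWidth K d) M w (fullType d M w)

    TypesUnique : ℕ → Set
    TypesUnique d = ∀ {M′ : Model m a} {w′ τ} u →
      IsTypeOf (constWidth K d) M′ w′ τ → M , u ⊨ τ → τ ≡ fullType d M u

    isType-step : ∀ d → FullTypeIsType d → TypesUnique d → FullTypeIsType (suc d)
    isType-step d isType unique w = IsConjOf-resp (λ χ → mk⇔ to from) (fullType-IsConjOf d M w)
      where
      to : ∀ {χ} → FullTypeConjunct d M w χ → Conjunct (λ _ → K) (constWidth K d) M w χ
      to valuation = inj₁ refl
      to (degree α) = inj₂ (inj₂ (inj₂ (α , bounded α w , refl)))
      to (successor α v Rwv) = inj₂ (inj₁ (α , _ , fullType d M v ,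
        witness⇒count-pos _ v (∧-intro Rwv (⊨fullType d M v)) , succCount<K α w (fullType d M v) ,
        (M , v , isType v) , ≡⇒⊨◇= M α w (fullType d M v) refl , refl))
      from : ∀ {χ} → Conjunct (λ _ → K) (constWidth K d) M w χ → FullTypeConjunct d M w χ
      from (inj₁ refl) = valuation
      from (inj₂ (inj₁ (α , ℓ , σ , 1≤ℓ , _ , (_ , _ , σ-type) , ⊨χ , refl)))
        with count-witness _ (subst (0 <_) (⊨◇=⇒≡ M α w σ ⊨χ) 1≤ℓ)
      ... | x , x∈ with ∧-elim x∈
      ...   | Rwx , ⊨σ with unique x σ-type ⊨σ | ⊨◇=⇒≡ M α w σ ⊨χ
      ...     | refl | refl = successor α x Rwx
      from (inj₂ (inj₂ (inj₁ (α , σ , _ , ⊨χ , refl)))) = ⊥-elim (⊭◇≥K α w σ ⊨χ)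
      from (inj₂ (inj₂ (inj₂ (α , _ , refl)))) = degree α

    -- With types σⱼ of all points j of M′ at hand, τ forces every successor of w′ into a
    -- class fullType d M x of a successor x of u, with the same multiplicity.
    module SuccessorMatching (d : ℕ) (isType : FullTypeIsType d) (unique : TypesUnique d)
      {M′ : Model m a} {w′ : Fin (size M′)} {τ : Fm m a} (u : Fin (size M))
      (τ-type : IsTypeOf (constWidth K (suc d)) M′ w′ τ) (⊨τ : M , u ⊨ τ)
      (types : ∀ j → ∃ λ σ → IsTypeOf (constWidth K d) M′ j σ)
      where

      open DepthClasses d M M′
      open ClassCounting ≈-isEquivalence inClass (inClass⇔ (fullType-agree d))

      ⊨conjunct : ∀ {χ} → Conjunct (λ _ → K) (constWidth K d) M′ w′ χ → M , u ⊨ χ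
      ⊨conjunct = ⊨IsConjOf⁻ τ-type ⊨τ

      succCount′<K : ∀ α σ → InT (constWidth K d) σ → succCount M′ α w′ σ < K
      succCount′<K α σ σ∈T = ℕₚ.≰⇒> λ K≤ →
        ⊭◇≥K α u σ (⊨conjunct (inj₂ (inj₂ (inj₁ (α , σ , σ∈T , ≤⇒⊨◇≥ M′ α w′ σ K≤ , refl)))))

      succCount-transfer : ∀ α σ → InT (constWidth K d) σ → 0 < succCount M′ α w′ σ →
        succCount M′ α w′ σ ≡ succCount M α u σ
      succCount-transfer α σ σ∈T pos = ⊨◇=⇒≡ M α u σ (⊨conjunct (inj₂ (inj₁
        (α , _ , σ , pos , succCount′<K α σ σ∈T , σ∈T , ≡⇒⊨◇= M′ α w′ σ refl , refl))))

      covered : ∀ α j → R M′ α w′ j ≡ true → ∃ λ x → R M α u x ≡ true × inj₂ j ≈ inj₁ x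
      covered α j Rw′j with types j
      ... | σ , σ-type
        with count-witness _ (subst (0 <_) (succCount-transfer α σ (M′ , j , σ-type) j-counted) j-counted)
        where
        j-counted : 0 < succCount M′ α w′ σ
        j-counted = witness⇒count-pos _ j (∧-intro Rw′j (IsTypeOf⇒⊨ (constWidth K d) σ-type))
      ... | x , x∈ with ∧-elim x∈
      ...   | Rux , ⊨σ with unique x σ-type ⊨σ
      ...     | refl =
        x , Rux , Equivalence.to (inClass⇔ (fullType-agree d) x (inj₂ j)) (IsTypeOf⇒⊨ (constWidth K d) σ-type)

      classes≡ : ∀ α x → R M α u x ≡ true → 0 < classCount (R M′ α w′) inj₂ x →
        classCount (R M′ α w′) inj₂ x ≡ classCount (R M α u) inj₁ x
      classes≡ α x _ = succCount-transfer α (fullType d M x) (M , x , isType x)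

      deg≡ : ∀ α → deg M′ α w′ ≡ deg M α u
      deg≡ α =
        trans (⊨◇=⇒≡ M α u ⊤' (⊨conjunct (inj₂ (inj₂ (inj₂ (α , deg′<K , refl)))))) (succCount-⊤ M α u)
        where
        deg′<K : deg M′ α w′ < K
        deg′<K = ℕₚ.≤-<-trans
          (proj₁ (covered-count (R M α u) (R M′ α w′) (covered α) (classes≡ α))) (bounded α u)

      ⊨fullType-at-w′ : M′ , w′ ⊨ fullType (suc d) M u
      ⊨fullType-at-w′ = ⊨fullType⁺ d M u λ where
        _ valuation → subst (M′ , w′ ⊨_) (⊨τε⇒τε≡ {M = M′} {M′ = M} (⊨conjunct (inj₁ refl))) (⊨τε M′ w′)
        _ (degree α) → ≡⇒⊨◇= M′ α w′ ⊤' (trans (sym (deg≡ α)) (sym (succCount-⊤ M′ α w′)))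
        _ (successor α x Rux) → ≡⇒⊨◇= M′ α w′ (fullType d M x)
          (sym (proj₂ (covered-count (R M α u) (R M′ α w′) (covered α) (classes≡ α)) (deg≡ α) x Rux))

    unique-step : ∀ d → FullTypeIsType d → TypesUnique d → TypesUnique (suc d)
    unique-step d isType unique {M′} {w′} u τ-type ⊨τ =
      IsConjOf-unique (IsTypeOf-transfer (constWidth K (suc d)) (ModalEquiv-sym u≡w′) τ-type)
                      (isType-step d isType unique u)
      where
      -- Types of the points of M′ exist only under ¬¬, but the goal is a Boolean equation.
      ⊨fullType-at-w′ : M′ , w′ ⊨ fullType (suc d) M u
      ⊨fullType-at-w′ = decidable-stable (sat M′ (fullType (suc d) M u) w′ ≟ᵇ true)
        (¬¬-map (SuccessorMatching.⊨fullType-at-w′ d isType unique u τ-type ⊨τ)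
          (sequence (RawMonad.rawApplicative ¬¬-Monad) (Candidates.type-exists K 1≤K d M′)))
      u≡w′ : ModalEquiv (suc d) M u M′ w′
      u≡w′ = fullType-agree (suc d) M M′ u w′ ⊨fullType-at-w′

    isType-and-unique : ∀ d → FullTypeIsType d × TypesUnique d
    isType-and-unique zero = (λ _ → refl) , λ {M′} u τ≡τε ⊨τ →
      trans τ≡τε (⊨τε⇒τε≡ {M = M′} {M′ = M} (subst (M , u ⊨_) τ≡τε ⊨τ))
    isType-and-unique (suc d) = isType-step d isType unique , λ {M′} → unique-step d isType unique {M′}
      where
      isType : FullTypeIsType d
      isType = proj₁ (isType-and-unique d)
      unique : TypesUnique d
      unique = proj₂ (isType-and-unique d)

    fullType-isType : ∀ d w → IsTypeOf (constWidth K d) M w (fullType d M w)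
    fullType-isType d = proj₁ (isType-and-unique d)

-- Enumerating finite pointed models

toBits : ℕᵇ → List Bool
toBits 0ᵇ = []
toBits 2[1+ x ] = true ∷ toBits x
toBits 1+[2 x ] = false ∷ toBits x

fromBits : List Bool → ℕᵇ
fromBits [] = 0ᵇ
fromBits (true ∷ l) = 2[1+ fromBits l ]
fromBits (false ∷ l) = 1+[2 fromBits l ]

toBits-fromBits : ∀ l → toBits (fromBits l) ≡ l
toBits-fromBits [] = refl
toBits-fromBits (true ∷ l) = cong (true ∷_) (toBits-fromBits l)
toBits-fromBits (false ∷ l) = cong (false ∷_) (toBits-fromBits l)

bitsOf : ℕ → List Bool
bitsOf = toBits ∘ toBinary

bitsOf-surjective : ∀ l → bitsOf (fromBinary (fromBits l)) ≡ l
bitsOf-surjective l = trans (cong toBits (fromℕ-toℕ (fromBits l))) (toBits-fromBits l)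

Decoder : Set → Set
Decoder A = List Bool → A × List Bool

RoundTrip : {A : Set} → (A → A → Set) → Decoder A → (A → List Bool) → Set
RoundTrip _≈_ decode encode = ∀ x rest →
  proj₁ (decode (encode x ++ rest)) ≈ x × proj₂ (decode (encode x ++ rest)) ≡ rest

decodeBool : Decoder Bool
decodeBool [] = false , []
decodeBool (b ∷ l) = b , l

decodeBool-roundTrip : RoundTrip _≡_ decodeBool (_∷ [])
decodeBool-roundTrip b rest = refl , refl

decodeℕ : Decoder ℕ
decodeℕ [] = 0 , []
decodeℕ (false ∷ l) = 0 , l
decodeℕ (true ∷ l) = map₁ suc (decodeℕ l)

encodeℕ : ℕ → List Bool
encodeℕ zero = false ∷ []
encodeℕ (suc n) = true ∷ encodeℕ n

decodeℕ-encodeℕ : ∀ n rest → decodeℕ (encodeℕ n ++ rest) ≡ (n , rest)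
decodeℕ-encodeℕ zero rest = refl
decodeℕ-encodeℕ (suc n) rest rewrite decodeℕ-encodeℕ n rest = refl

module _ {A : Set} where

  decodeFun : (n : ℕ) → Decoder A → Decoder (Fin n → A)
  decodeFun zero decode l = (λ ()) , l
  decodeFun (suc n) decode l = map₁ (proj₁ (decode l) ◂_) (decodeFun n decode (proj₂ (decode l)))

  encodeFun : (n : ℕ) → (A → List Bool) → (Fin n → A) → List Bool
  encodeFun zero encode f = []
  encodeFun (suc n) encode f = encode (f fzero) ++ encodeFun n encode (f ∘ fsuc)

  decodeFun-roundTrip : ∀ n {_≈_ : A → A → Set} {decode encode} → RoundTrip _≈_ decode encode →
    RoundTrip (λ f g → ∀ i → f i ≈ g i) (decodeFun n decode) (encodeFun n encode)
  decodeFun-roundTrip zero roundTrip f rest = (λ ()) , refl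
  decodeFun-roundTrip (suc n) {_≈_} {decode} {encode} roundTrip f rest
    rewrite ++-assoc (encode (f fzero)) (encodeFun n encode (f ∘ fsuc)) rest
    with decode (encode (f fzero) ++ encodeFun n encode (f ∘ fsuc) ++ rest)
       | roundTrip (f fzero) (encodeFun n encode (f ∘ fsuc) ++ rest)
       | decodeFun-roundTrip n {_≈_} roundTrip (f ∘ fsuc) rest
  ... | x , _ | x≈ , refl | tail≈ , tail≡ = (λ { fzero → x≈ ; (fsuc i) → tail≈ i }) , tail≡

PointedModel : ℕ → ℕ → Set
PointedModel m a = Σ (Model m a) λ M → Fin (size M)

module _ {m a : ℕ} where

  decodeR : (s : ℕ) → Decoder (Fin a → Fin s → Fin s → Bool)
  decodeR s = decodeFun a (decodeFun s (decodeFun s decodeBool))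

  encodeR : (s : ℕ) → (Fin a → Fin s → Fin s → Bool) → List Bool
  encodeR s = encodeFun a (encodeFun s (encodeFun s (_∷ [])))

  decodeV : (s : ℕ) → Decoder (Fin m → Fin s → Bool)
  decodeV s = decodeFun m (decodeFun s decodeBool)

  encodeV : (s : ℕ) → (Fin m → Fin s → Bool) → List Bool
  encodeV s = encodeFun m (encodeFun s (_∷ []))

  decodeR-roundTrip : ∀ s → RoundTrip (λ R′ R″ → ∀ α v x → R′ α v x ≡ R″ α v x) (decodeR s) (encodeR s)
  decodeR-roundTrip s = decodeFun-roundTrip a {λ f g → ∀ v x → f v x ≡ g v x}
    (decodeFun-roundTrip s {λ f g → ∀ x → f x ≡ g x} (decodeFun-roundTrip s {_≡_} decodeBool-roundTrip))

  decodeV-roundTrip : ∀ s → RoundTrip (λ V′ V″ → ∀ p v → V′ p v ≡ V″ p v) (decodeV s) (encodeV s)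
  decodeV-roundTrip s =
    decodeFun-roundTrip m {λ f g → ∀ v → f v ≡ g v} (decodeFun-roundTrip s {_≡_} decodeBool-roundTrip)

  pointedModel : (s w : ℕ) → (Fin a → Fin s → Fin s → Bool) → (Fin m → Fin s → Bool) →
    Maybe (PointedModel m a)
  pointedModel s w R′ V′ with w <? s
  ... | yes w<s = just (record { size = s ; R = R′ ; V = V′ } , fromℕ< w<s)
  ... | no _ = nothing

  pointedModel-toℕ : ∀ s (w : Fin s) R′ V′ →
    pointedModel s (toℕ w) R′ V′ ≡ just (record { size = s ; R = R′ ; V = V′ } , w)
  pointedModel-toℕ s w R′ V′ with toℕ w <? s
  ... | yes w<s = cong (λ w′ → just (record { size = s ; R = R′ ; V = V′ } , w′)) (fromℕ<-toℕ w w<s)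
  ... | no w≮s = ⊥-elim (w≮s (toℕ<n w))

  decodePointedModel : List Bool → Maybe (PointedModel m a)
  decodePointedModel l₀ =
    let s , l₁ = decodeℕ l₀
        w , l₂ = decodeℕ l₁
        R′ , l₃ = decodeR s l₂
        V′ , _ = decodeV s l₃
    in pointedModel s w R′ V′

  encodePointedModel : PointedModel m a → List Bool
  encodePointedModel (M , w) =
    encodeℕ (size M) ++ encodeℕ (toℕ w) ++ encodeR (size M) (R M) ++ encodeV (size M) (V M) ++ []

  withRV : (M : Model m a) → (Fin a → Fin (size M) → Fin (size M) → Bool) → (Fin m → Fin (size M) → Bool) →
    Model m a
  withRV M R′ V′ = record { size = size M ; R = R′ ; V = V′ }

  decodePointedModel-encode : ∀ (M : Model m a) w → ∃₂ λ R′ V′ →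
    decodePointedModel (encodePointedModel (M , w)) ≡ just (withRV M R′ V′ , w) ×
    (∀ α v x → R′ α v x ≡ R M α v x) × (∀ p v → V′ p v ≡ V M p v)
  decodePointedModel-encode M w
    rewrite decodeℕ-encodeℕ (size M)
              (encodeℕ (toℕ w) ++ encodeR (size M) (R M) ++ encodeV (size M) (V M) ++ [])
          | decodeℕ-encodeℕ (toℕ w) (encodeR (size M) (R M) ++ encodeV (size M) (V M) ++ [])
    with decodeR (size M) (encodeR (size M) (R M) ++ encodeV (size M) (V M) ++ [])
       | decodeR-roundTrip (size M) (R M) (encodeV (size M) (V M) ++ [])
  ... | R′ , _ | R′≈ , refl =
    R′ , V′ , pointedModel-toℕ (size M) w R′ V′ , R′≈ , proj₁ (decodeV-roundTrip (size M) (V M) [])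
    where
    V′ : Fin m → Fin (size M) → Bool
    V′ = proj₁ (decodeV (size M) (encodeV (size M) (V M) ++ []))

  sat-withRV : (M : Model m a)
    {R′ : Fin a → Fin (size M) → Fin (size M) → Bool} {V′ : Fin m → Fin (size M) → Bool} →
    (∀ α v x → R′ α v x ≡ R M α v x) → (∀ p v → V′ p v ≡ V M p v) →
    ∀ φ w → sat (withRV M R′ V′) φ w ≡ sat M φ w
  sat-withRV M R′≈ V′≈ ⊤' w = refl
  sat-withRV M R′≈ V′≈ (var p) w = V′≈ p w
  sat-withRV M R′≈ V′≈ (¬' φ) w = cong not (sat-withRV M R′≈ V′≈ φ w)
  sat-withRV M R′≈ V′≈ (φ ∧' ψ) w = cong₂ _∧_ (sat-withRV M R′≈ V′≈ φ w) (sat-withRV M R′≈ V′≈ ψ w)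
  sat-withRV M R′≈ V′≈ (◇≥ α k φ) w =
    cong (k ≤ᵇ_) (count-cong λ v → cong₂ _∧_ (R′≈ α w v) (sat-withRV M R′≈ V′≈ φ v))

  fullType-IsFullType : ∀ d (M : Model m a) w → IsFullType d (fullType d M w)
  fullType-IsFullType d M w = M , w , constWidth K d , fullWidth ,
    fullType-isType K (s≤s z≤n) M (λ α v → s≤s (count-≤ (R M α v))) d w
    where
    K : ℕ
    K = suc (size M)
    fullWidth : FullWidth M w (constWidth K d)
    fullWidth i α = subst (λ k → 0 < k × (∀ v → Reach M (toℕ i) w v → deg M α v < k))
      (sym (lookup-constWidth K d i α)) (s≤s z≤n , λ v _ → s≤s (count-≤ (R M α v)))

  typeIfSatisfies : Fm m a → Maybe (PointedModel m a) → Maybe (Fm m a)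
  typeIfSatisfies φ nothing = nothing
  typeIfSatisfies φ (just (M , w)) = if sat M φ w then just (fullType (md φ) M w) else nothing

  typeIfSatisfies⁻ : ∀ φ x {ψ} → typeIfSatisfies φ x ≡ just ψ →
    ∃₂ λ (M : Model m a) w → M , w ⊨ φ × ψ ≡ fullType (md φ) M w
  typeIfSatisfies⁻ φ (just (M , w)) found with sat M φ w in ⊨φ
  typeIfSatisfies⁻ φ (just (M , w)) refl | true = M , w , ⊨φ , refl

  typeIfSatisfies⁺ : ∀ φ (M : Model m a) w → M , w ⊨ φ →
    typeIfSatisfies φ (just (M , w)) ≡ just (fullType (md φ) M w)
  typeIfSatisfies⁺ φ M w ⊨φ rewrite ⊨φ = refl

  enumerate : Fm m a → ℕ → Maybe (Fm m a)
  enumerate φ i = typeIfSatisfies φ (decodePointedModel (bitsOf i))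

  enumerate-IsFullType : ∀ φ i ψ → enumerate φ i ≡ just ψ → IsFullType (md φ) ψ
  enumerate-IsFullType φ i ψ found with typeIfSatisfies⁻ φ (decodePointedModel (bitsOf i)) found
  ... | M , w , _ , refl = fullType-IsFullType (md φ) M w

  ⊨⇔enumerate : ∀ φ (M : Model m a) w →
    (M , w ⊨ φ) ⇔ (Σ ℕ λ i → Σ (Fm m a) λ ψ → (enumerate φ i ≡ just ψ) × (M , w ⊨ ψ))
  ⊨⇔enumerate φ M w = mk⇔ to from
    where
    to : M , w ⊨ φ → Σ ℕ λ i → Σ (Fm m a) λ ψ → (enumerate φ i ≡ just ψ) × (M , w ⊨ ψ)
    to ⊨φ with decodePointedModel-encode M w
    ... | R′ , V′ , decoded , R′≈ , V′≈ =
      fromBinary (fromBits l) , fullType (md φ) M′ w , found , ⊨type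
      where
      l : List Bool
      l = encodePointedModel (M , w)
      M′ : Model m a
      M′ = withRV M R′ V′
      found : enumerate φ (fromBinary (fromBits l)) ≡ just (fullType (md φ) M′ w)
      found = begin
        typeIfSatisfies φ (decodePointedModel (bitsOf (fromBinary (fromBits l))))
          ≡⟨ cong (typeIfSatisfies φ ∘ decodePointedModel) (bitsOf-surjective l) ⟩
        typeIfSatisfies φ (decodePointedModel l) ≡⟨ cong (typeIfSatisfies φ) decoded ⟩
        typeIfSatisfies φ (just (M′ , w))
          ≡⟨ typeIfSatisfies⁺ φ M′ w (trans (sat-withRV M R′≈ V′≈ φ w) ⊨φ) ⟩
        just (fullType (md φ) M′ w)             ∎
        where open ≡-Reasoning
      ⊨type : M , w ⊨ fullType (md φ) M′ w
      ⊨type = trans (sym (sat-withRV M R′≈ V′≈ (fullType (md φ) M′ w) w)) (⊨fullType (md φ) M′ w)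
    from : (Σ ℕ λ i → Σ (Fm m a) λ ψ → (enumerate φ i ≡ just ψ) × (M , w ⊨ ψ)) → M , w ⊨ φ
    from (i , ψ , found , ⊨ψ) with typeIfSatisfies⁻ φ (decodePointedModel (bitsOf i)) found
    ... | M′ , w′ , M′⊨φ , refl = trans (sym (fullType-agree (md φ) M′ M w′ w ⊨ψ φ ℕₚ.≤-refl)) M′⊨φ

lemma1 : ∀ {m a′ : ℕ} (φ : Fm m (suc a′)) →
    Σ (ℕ → Maybe (Fm m (suc a′))) λ f →
      (∀ (i : ℕ) (ψ : Fm m (suc a′)) → f i ≡ just ψ → IsFullType (md φ) ψ) ×
      (∀ (M : Model m (suc a′)) (w : Fin (size M)) →
        (M , w ⊨ φ) ⇔ (Σ ℕ λ i → Σ (Fm m (suc a′)) λ ψ → (f i ≡ just ψ) × (M , w ⊨ ψ)))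
lemma1 φ = enumerate φ , enumerate-IsFullType φ , ⊨⇔enumerate φ
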